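{- For every constant integer $r\ge 1$ there exist an unweighted planar directed graph $G=(V,E)$ and a set $X\subseteq E$ of $r$ edges such that $X$ is shattered by the family $\overrightarrow{\mathcal{SP}}(G)=\{\tau_v: v\in V\}$ of subsets of $E$, where $\tau_v$ is the (edge set of the) shortest path tree of $G$ rooted at $v$.
   Context: For $v\in V$, $\tau_v$ is an out-tree rooted at $v$ consisting of shortest directed paths from $v$ to all vertices reachable from $v$; ties among shortest paths are broken consistently across all roots. A set $X\subseteq E$ is shattered by a family $\mathcal{F}$ of subsets of $E$ if $\{X\cap F: F\in\mathcal{F}\}=2^X$. -}

module Defs where

open import Data.Nat using (ℕ; zero; suc; _≤_)
open import Data.Fin using (Fin)
open import Data.Bool using (Bool; true)
open import Data.Maybe using (Maybe; just; nothing)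
open import Data.Product using (Σ; ∃; _×_; _,_)
open import Data.Sum using (_⊎_)
open import Function using (_⇔_)
open import Function.Definitions using (Injective)
open import Relation.Nullary using (¬_)
open import Relation.Binary.PropositionalEquality using (_≡_; _≢_)
open import Data.Rational as ℚ using (ℚ; 0ℚ; 1ℚ)

record Digraph : Set where
  field
    n   : ℕ
    m   : ℕ
    src : Fin m → Fin n
    tgt : Fin m → Fin n
open Digraph public

module _ (G : Digraph) where

  Vtx : Set
  Vtx = Fin (n G)

  Edge : Set
  Edge = Fin (m G)

  data Walk : Vtx → Vtx → ℕ → Set where
    nil  : ∀ {u} → Walk u u zero
    cons : ∀ {k w} (e : Edge) → Walk (tgt G e) w k → Walk (src G e) w (suc k)

  Reachable : Vtx → Vtx → Set
  Reachable u w = ∃ λ k → Walk u w k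

  Dist : Vtx → Vtx → ℕ → Set
  Dist u w k = Walk u w k × (∀ j → Walk u w j → k ≤ j)

  -- A system of shortest-path out-trees {τ_v : v ∈ V} with ties broken
  -- consistently.  It is given by parent-edge functions: par v w is the
  -- last edge of the chosen shortest v→w path (nothing iff w = v or w is
  -- unreachable from v).  The chosen v→w path is obtained by following
  -- parents back to v; so every τ_v is an out-tree rooted at v made of
  -- shortest paths to all vertices reachable from v.

  data OnPath (par : Vtx → Vtx → Maybe Edge) (v : Vtx) : Vtx → Vtx → Set where
    here  : ∀ {w} → OnPath par v w w
    there : ∀ {x w e} → par v w ≡ just e → OnPath par v x (src G e) → OnPath par v x w

  record SPTSystem : Set where
    field
      par : Vtx → Vtx → Maybe Edge
      par-root  : ∀ v → par v v ≡ nothing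
      par-reach : ∀ v w → v ≢ w → Reachable v w → ∃ λ e → par v w ≡ just e
      par-edge  : ∀ v w e → par v w ≡ just e →
                  tgt G e ≡ w × ∃ λ k → Dist v (src G e) k × Dist v w (suc k)
      -- consistency across roots: the chosen path from any vertex x on
      -- the chosen v→w path is the corresponding suffix of that path
      consistent : ∀ v x w → OnPath par v x w → x ≢ w → par x w ≡ par v w

    τ : Vtx → Edge → Set
    τ v e = ∃ λ w → par v w ≡ just e

  -- Planarity (of the underlying undirected graph) via straight-line
  -- drawings in ℚ² (Fáry's theorem): vertices at distinct points, each
  -- edge drawn as the segment between its endpoints, two segments meet
  -- only in common endpoints (unless they join the same pair of
  -- vertices), and no vertex lies on an edge not incident to it.

  Point : Set
  Point = ℚ × ℚ

  InUnit : ℚ → Set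
  InUnit t = 0ℚ ℚ.≤ t × t ℚ.≤ 1ℚ

  Incident : Vtx → Edge → Set
  Incident w e = w ≡ src G e ⊎ w ≡ tgt G e

  SameEnds : Edge → Edge → Set
  SameEnds e f = (src G e ≡ src G f × tgt G e ≡ tgt G f)
               ⊎ (src G e ≡ tgt G f × tgt G e ≡ src G f)

  segPt : (Vtx → Point) → Edge → ℚ → Point
  segPt pos e t with pos (src G e) | pos (tgt G e)
  ... | (a₁ , a₂) | (b₁ , b₂) =
    ((1ℚ ℚ.- t) ℚ.* a₁ ℚ.+ t ℚ.* b₁ , (1ℚ ℚ.- t) ℚ.* a₂ ℚ.+ t ℚ.* b₂)

  record StraightLineDrawing : Set where
    field
      pos       : Vtx → Point
      pos-inj   : Injective _≡_ _≡_ pos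
      edges-ok  : ∀ e f s t → InUnit s → InUnit t → segPt pos e s ≡ segPt pos f t →
                  SameEnds e f ⊎ (∃ λ w → Incident w e × Incident w f × segPt pos e s ≡ pos w)
      vertex-ok : ∀ w e t → InUnit t → segPt pos e t ≡ pos w → Incident w e

  Planar : Set
  Planar = StraightLineDrawing

-- X ⊆ E given as an injective map Fin r → E; X is shattered by the
-- family {τ_v : v ∈ V} iff every subset S ⊆ X equals X ∩ τ_v for some v.

Shattered : (G : Digraph) (T : SPTSystem G) {r : ℕ} → (Fin r → Edge G) → Set
Shattered G T {r} X = ∀ (S : Fin r → Bool) → ∃ λ (v : Vtx G) →
  ∀ i → (S i ≡ true ⇔ SPTSystem.τ T v (X i))

module Submission where

open import Data.Nat as ℕ using (ℕ; zero; suc; z≤n; s≤s; _<_; _≤_; _≥_)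
import Data.Nat.Properties as ℕP
open import Data.Nat.Solver using (module +-*-Solver)
open import Algebra.Properties.CommutativeSemigroup ℕP.+-commutativeSemigroup using (x∙yz≈y∙xz; xy∙z≈xz∙y)
open import Data.Fin as Fin using (Fin; toℕ; fromℕ<; combine; remQuot)
import Data.Fin.Properties as FinP
open import Data.Bool using (Bool; true; false; not; if_then_else_)
import Data.Bool.Properties as BoolP
open import Data.Maybe using (Maybe; just; nothing; map)
open import Data.Maybe.Properties using (just-injective)
open import Data.Product using (_×_; _,_; Σ; ∃; proj₁; proj₂; uncurry)
open import Data.Product.Properties using (×-≡,≡→≡)
open import Data.Sum using (_⊎_; inj₁; inj₂)
open import Function using (_∘_)
open import Function.Bundles using (mk⇔)
open import Function.Definitions using (Injective)
open import Relation.Binary.PropositionalEquality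
open import Relation.Nullary using (¬_; yes; no; does; Dec; contradiction)
open import Relation.Nullary.Decidable using (dec-yes-irr; dec-no; _×-dec_)
open import Defs

-- Index the 2^r subsets of {0, …, r - 1} by the numbers z < 2^r and give each a
-- root v_z on a horizontal baseline; put the terminals t_0, …, t_{r-1} further right on it.
-- From v_z a route in the upper half-plane and its mirror image in the lower half-plane
-- lead to t_j: climb to level j + 1, ride right over one bump per column, descend, and enter
-- t_j by the edge X_j (upper) or Y_j (lower).  The bump heights are chosen so that the two
-- ride lengths telescope to values differing by exactly 2, the upper one being shorter iff
-- bit j of z is 1.  A potential that drops by at most one along every edge and vanishes at the
-- start of X_j (resp. Y_j) shows that no walk from v_z beats these routes, so the last edge
-- of a shortest v_z–t_j path, i.e. the tree edge into t_j, is X_j iff bit j of z is 1.  Every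
-- edge joins lattice points at distance one (or is a loop), so the graph is planar.

module LatticeDrawing where

  open import Data.Rational as ℚ using (ℚ; 0ℚ; 1ℚ; _+_; _*_; _-_)
  import Data.Rational.Properties as ℚP
  import Data.Rational.Solver as ℚ-Solver
  open import Relation.Binary using (tri<; tri≈; tri>)
  open import Relation.Nullary.Decidable using (toWitness)

  fromℕ : ℕ → ℚ
  fromℕ zero    = 0ℚ
  fromℕ (suc n) = fromℕ n + 1ℚ

  In[0,1] : ℚ → Set
  In[0,1] t = 0ℚ ℚ.≤ t × t ℚ.≤ 1ℚ

  0ℚ<1ℚ : 0ℚ ℚ.< 1ℚ
  0ℚ<1ℚ = toWitness {a? = 0ℚ ℚP.<? 1ℚ} _

  p≤p+q : ∀ p {q} → 0ℚ ℚ.≤ q → p ℚ.≤ p + q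
  p≤p+q p 0≤q = subst (ℚ._≤ p + _) (ℚP.+-identityʳ p) (ℚP.+-monoʳ-≤ p 0≤q)

  p<p+q : ∀ p {q} → 0ℚ ℚ.< q → p ℚ.< p + q
  p<p+q p 0<q = subst (ℚ._< p + _) (ℚP.+-identityʳ p) (ℚP.+-monoʳ-< p 0<q)

  fromℕ-mono-< : ∀ {m n} → m ℕ.< n → fromℕ m ℚ.< fromℕ n
  fromℕ-mono-< {m} {suc n} (s≤s m≤n) with ℕP.m≤n⇒m<n∨m≡n m≤n
  ... | inj₁ m<n  = ℚP.<-trans (fromℕ-mono-< m<n) (p<p+q (fromℕ n) 0ℚ<1ℚ)
  ... | inj₂ refl = p<p+q (fromℕ n) 0ℚ<1ℚ

  fromℕ-cancel-≤ : ∀ {m n} → fromℕ m ℚ.≤ fromℕ n → m ℕ.≤ n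
  fromℕ-cancel-≤ {m} {n} le with m ℕ.≤? n
  ... | yes m≤n = m≤n
  ... | no  m≰n = contradiction (ℚP.≤-<-trans le (fromℕ-mono-< (ℕP.≰⇒> m≰n))) (ℚP.<-irrefl refl)

  fromℕ-injective : ∀ {m n} → fromℕ m ≡ fromℕ n → m ≡ n
  fromℕ-injective eq = ℕP.≤-antisym (fromℕ-cancel-≤ (ℚP.≤-reflexive eq))
                                    (fromℕ-cancel-≤ (ℚP.≤-reflexive (sym eq)))

  lattice-point-of-unit-interval : ∀ x n {t} → In[0,1] t → fromℕ x + t ≡ fromℕ n → n ≡ x ⊎ n ≡ suc x
  lattice-point-of-unit-interval x n {t} (0≤t , t≤1) eq = cases (ℕP.m≤n⇒m<n∨m≡n x≤n)
    where
    x≤n : x ℕ.≤ n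
    x≤n = fromℕ-cancel-≤ (subst (fromℕ x ℚ.≤_) eq (p≤p+q (fromℕ x) 0≤t))
    n≤1+x : n ℕ.≤ suc x
    n≤1+x = fromℕ-cancel-≤ (subst (ℚ._≤ fromℕ (suc x)) eq (ℚP.+-monoʳ-≤ (fromℕ x) t≤1))
    cases : x ℕ.< n ⊎ x ≡ n → n ≡ x ⊎ n ≡ suc x
    cases (inj₁ x<n)  = inj₂ (ℕP.≤-antisym n≤1+x x<n)
    cases (inj₂ refl) = inj₁ refl

  unit-intervals-touch : ∀ {x y s t} → x ℕ.< y → s ℚ.≤ 1ℚ → 0ℚ ℚ.≤ t → fromℕ x + s ≡ fromℕ y + t →
                         suc x ≡ y × fromℕ y + t ≡ fromℕ y
  unit-intervals-touch {x} {y} {s} {t} x<y s≤1 0≤t eq =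
    fromℕ-injective (ℚP.≤-antisym 1+x≤y y≤1+x) , ℚP.≤-antisym (ℚP.≤-trans y+t≤1+x 1+x≤y) (p≤p+q (fromℕ y) 0≤t)
    where
    y+t≤1+x : fromℕ y + t ℚ.≤ fromℕ (suc x)
    y+t≤1+x = subst (ℚ._≤ fromℕ (suc x)) eq (ℚP.+-monoʳ-≤ (fromℕ x) s≤1)
    1+x≤y : fromℕ (suc x) ℚ.≤ fromℕ y
    1+x≤y with ℕP.m≤n⇒m<n∨m≡n x<y
    ... | inj₁ 1+x<y = ℚP.<⇒≤ (fromℕ-mono-< 1+x<y)
    ... | inj₂ refl  = ℚP.≤-refl
    y≤1+x : fromℕ y ℚ.≤ fromℕ (suc x)
    y≤1+x = ℚP.≤-trans (p≤p+q (fromℕ y) 0≤t) y+t≤1+x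

  data IntervalsMeet (x y : ℕ) (s t : ℚ) : Set where
    coincide : x ≡ y → IntervalsMeet x y s t
    at-start-of-y : suc x ≡ y → fromℕ y + t ≡ fromℕ y → IntervalsMeet x y s t
    at-start-of-x : suc y ≡ x → fromℕ x + s ≡ fromℕ x → IntervalsMeet x y s t

  unit-intervals-meet : ∀ x y {s t} → In[0,1] s → In[0,1] t → fromℕ x + s ≡ fromℕ y + t → IntervalsMeet x y s t
  unit-intervals-meet x y (0≤s , s≤1) (0≤t , t≤1) eq with ℕP.<-cmp x y
  ... | tri≈ _ x≡y _ = coincide x≡y
  ... | tri< x<y _ _ = let (1+x≡y , touch) = unit-intervals-touch x<y s≤1 0≤t eq in at-start-of-y 1+x≡y touch
  ... | tri> _ _ y<x = let (1+y≡x , touch) = unit-intervals-touch y<x t≤1 0≤s (sym eq) in at-start-of-x 1+y≡x touch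

  UnitStep : {V : Set} (X Y : V → ℕ) → V → V → Set
  UnitStep X Y u w = (Y w ≡ Y u × X w ≡ suc (X u)) ⊎ (X w ≡ X u × Y w ≡ suc (Y u))

  module UnitGrid
    (G : Digraph) (X Y : Vtx G → ℕ)
    (lattice-injective : ∀ {u v} → X u ≡ X v → Y u ≡ Y v → u ≡ v)
    (unit-edge : ∀ e → src G e ≡ tgt G e
                     ⊎ UnitStep X Y (src G e) (tgt G e)
                     ⊎ UnitStep X Y (tgt G e) (src G e))
    where

    open ℚ-Solver.+-*-Solver

    pos : Vtx G → Point G
    pos v = fromℕ (X v) , fromℕ (Y v)

    pos-injective : Injective _≡_ _≡_ pos
    pos-injective eq = lattice-injective (fromℕ-injective (cong proj₁ eq)) (fromℕ-injective (cong proj₂ eq))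

    lerp : Vtx G → Vtx G → ℚ → Point G
    lerp u w t = (1ℚ - t) * fromℕ (X u) + t * fromℕ (X w) , (1ℚ - t) * fromℕ (Y u) + t * fromℕ (Y w)

    segPt-reversed : ∀ e t → segPt G pos e t ≡ lerp (tgt G e) (src G e) (1ℚ - t)
    segPt-reversed e t = cong₂ _,_ (swap t (fromℕ (X (src G e))) (fromℕ (X (tgt G e))))
                                   (swap t (fromℕ (Y (src G e))) (fromℕ (Y (tgt G e))))
      where
      swap : ∀ t a b → (1ℚ - t) * a + t * b ≡ (1ℚ - (1ℚ - t)) * b + (1ℚ - t) * a
      swap = solve 3 (λ t a b → (con 1ℚ :- t) :* a :+ t :* b := (con 1ℚ :- (con 1ℚ :- t)) :* b :+ (con 1ℚ :- t) :* a) refl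

    lerp-constant : ∀ t a → (1ℚ - t) * a + t * a ≡ a
    lerp-constant = solve 2 (λ t a → (con 1ℚ :- t) :* a :+ t :* a := a) refl

    lerp-successor : ∀ t a → (1ℚ - t) * a + t * (a + 1ℚ) ≡ a + t
    lerp-successor = solve 2 (λ t a → (con 1ℚ :- t) :* a :+ t :* (a :+ con 1ℚ) := a :+ t) refl

    lerp-loop : ∀ {u} t → lerp u u t ≡ pos u
    lerp-loop {u} t = cong₂ _,_ (lerp-constant t (fromℕ (X u))) (lerp-constant t (fromℕ (Y u)))

    lerp-horizontal : ∀ {u w} t → Y w ≡ Y u → X w ≡ suc (X u) → lerp u w t ≡ (fromℕ (X u) + t , fromℕ (Y u))
    lerp-horizontal {u} t sy nx rewrite sy | nx = cong₂ _,_ (lerp-successor t (fromℕ (X u))) (lerp-constant t (fromℕ (Y u)))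

    lerp-vertical : ∀ {u w} t → X w ≡ X u → Y w ≡ suc (Y u) → lerp u w t ≡ (fromℕ (X u) , fromℕ (Y u) + t)
    lerp-vertical {u} t sx ny rewrite sx | ny = cong₂ _,_ (lerp-constant t (fromℕ (X u))) (lerp-successor t (fromℕ (Y u)))

    unit-flip : ∀ {t} → In[0,1] t → In[0,1] (1ℚ - t)
    unit-flip {t} (0≤t , t≤1) =
      subst₂ ℚ._≤_ (ℚP.+-inverseʳ t) refl (ℚP.+-monoˡ-≤ (ℚ.- t) t≤1) ,
      subst₂ ℚ._≤_ (ℚP.+-identityˡ (1ℚ - t)) (t+[1-t] t) (ℚP.+-monoˡ-≤ (1ℚ - t) 0≤t)
      where
      t+[1-t] : ∀ t → t + (1ℚ - t) ≡ 1ℚ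
      t+[1-t] = solve 1 (λ t → t :+ (con 1ℚ :- t) := con 1ℚ) refl

    Ends : Edge G → Vtx G → Vtx G → Set
    Ends e lo hi = (lo ≡ src G e × hi ≡ tgt G e) ⊎ (lo ≡ tgt G e × hi ≡ src G e)

    lo-incident : ∀ {e lo hi} → Ends e lo hi → Incident G lo e
    lo-incident (inj₁ (lo≡ , _)) = inj₁ lo≡
    lo-incident (inj₂ (lo≡ , _)) = inj₂ lo≡

    hi-incident : ∀ {e lo hi} → Ends e lo hi → Incident G hi e
    hi-incident (inj₁ (_ , hi≡)) = inj₂ hi≡
    hi-incident (inj₂ (_ , hi≡)) = inj₁ hi≡

    same-ends : ∀ {e f lo hi} → Ends e lo hi → Ends f lo hi → SameEnds G e f
    same-ends (inj₁ (a , b)) (inj₁ (c , d)) = inj₁ (trans (sym a) c , trans (sym b) d)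
    same-ends (inj₁ (a , b)) (inj₂ (c , d)) = inj₂ (trans (sym a) c , trans (sym b) d)
    same-ends (inj₂ (a , b)) (inj₁ (c , d)) = inj₂ (trans (sym b) d , trans (sym a) c)
    same-ends (inj₂ (a , b)) (inj₂ (c , d)) = inj₁ (trans (sym b) d , trans (sym a) c)

    record UnitSegment (e : Edge G) : Set where
      field
        lo hi     : Vtx G
        ends      : Ends e lo hi
        step      : UnitStep X Y lo hi
        traversal : ∀ t → In[0,1] t → ∃ λ t′ → In[0,1] t′ × segPt G pos e t ≡ lerp lo hi t′

    open UnitSegment

    data Shape (e : Edge G) : Set where
      loop    : src G e ≡ tgt G e → Shape e
      segment : UnitSegment e → Shape e

    shape : ∀ e → Shape e
    shape e with unit-edge e
    ... | inj₁ l         = loop l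
    ... | inj₂ (inj₁ st) = segment record
      { lo = src G e ; hi = tgt G e ; ends = inj₁ (refl , refl) ; step = st
      ; traversal = λ t u → t , u , refl }
    ... | inj₂ (inj₂ st) = segment record
      { lo = tgt G e ; hi = src G e ; ends = inj₂ (refl , refl) ; step = st
      ; traversal = λ t u → 1ℚ - t , unit-flip u , segPt-reversed e t }

    loop-point : ∀ e t → src G e ≡ tgt G e → segPt G pos e t ≡ pos (src G e)
    loop-point e t l = subst (λ w → lerp (src G e) w t ≡ pos (src G e)) l (lerp-loop t)

    EndOf : Edge G → Point G → Set
    EndOf e P = ∃ λ w → Incident G w e × P ≡ pos w

    end-at : ∀ {e P w} → EndOf e P → P ≡ pos w → Incident G w e
    end-at {e} (v , inc , P≡v) P≡w = subst (λ x → Incident G x e) (pos-injective (trans (sym P≡v) P≡w)) inc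

    horizontal-end : ∀ {e lo hi t} n → Ends e lo hi → Y hi ≡ Y lo → X hi ≡ suc (X lo) → In[0,1] t →
                     fromℕ (X lo) + t ≡ fromℕ n → EndOf e (fromℕ (X lo) + t , fromℕ (Y lo))
    horizontal-end {lo = lo} {hi} n ends sy nx u eq with lattice-point-of-unit-interval (X lo) n u eq
    ... | inj₁ refl = lo , lo-incident ends , cong₂ _,_ eq refl
    ... | inj₂ refl = hi , hi-incident ends , cong₂ _,_ (trans eq (cong fromℕ (sym nx))) (cong fromℕ (sym sy))

    vertical-end : ∀ {e lo hi t} n → Ends e lo hi → X hi ≡ X lo → Y hi ≡ suc (Y lo) → In[0,1] t →
                   fromℕ (Y lo) + t ≡ fromℕ n → EndOf e (fromℕ (X lo) , fromℕ (Y lo) + t)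
    vertical-end {lo = lo} {hi} n ends sx ny u eq with lattice-point-of-unit-interval (Y lo) n u eq
    ... | inj₁ refl = lo , lo-incident ends , cong₂ _,_ refl eq
    ... | inj₂ refl = hi , hi-incident ends , cong₂ _,_ (cong fromℕ (sym sx)) (trans eq (cong fromℕ (sym ny)))

    vertex-on-segment : ∀ {e t} w (σ : UnitSegment e) → In[0,1] t → lerp (lo σ) (hi σ) t ≡ pos w → Incident G w e
    vertex-on-segment {t = t} w σ u eq with step σ
    ... | inj₁ (sy , nx) = end-at (horizontal-end (X w) (ends σ) sy nx u (cong proj₁ eq′)) eq′
      where
      eq′ : (fromℕ (X (lo σ)) + t , fromℕ (Y (lo σ))) ≡ pos w
      eq′ = trans (sym (lerp-horizontal t sy nx)) eq
    ... | inj₂ (sx , ny) = end-at (vertical-end (Y w) (ends σ) sx ny u (cong proj₂ eq′)) eq′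
      where
      eq′ : (fromℕ (X (lo σ)) , fromℕ (Y (lo σ)) + t) ≡ pos w
      eq′ = trans (sym (lerp-vertical t sx ny)) eq

    vertex-ok : ∀ w e t → In[0,1] t → segPt G pos e t ≡ pos w → Incident G w e
    vertex-ok w e t u eq with shape e
    ... | loop l    = inj₁ (pos-injective (trans (sym eq) (loop-point e t l)))
    ... | segment σ = let (t′ , u′ , P≡) = traversal σ t u in vertex-on-segment w σ u′ (trans (sym P≡) eq)

    point : ∀ {e} → UnitSegment e → ℚ → Point G
    point σ = lerp (lo σ) (hi σ)

    SegmentsMeet : ∀ {e} → UnitSegment e → Edge G → ℚ → Set
    SegmentsMeet {e} σ f s = SameEnds G e f ⊎ EndOf e (point σ s) ⊎ EndOf f (point σ s)

    horizontal-segments-meet : ∀ {e f s t} (σ : UnitSegment e) (τ : UnitSegment f) → In[0,1] s → In[0,1] t → point σ s ≡ point τ t →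
                               Y (hi σ) ≡ Y (lo σ) → X (hi σ) ≡ suc (X (lo σ)) →
                               Y (hi τ) ≡ Y (lo τ) → X (hi τ) ≡ suc (X (lo τ)) → SegmentsMeet σ f s
    horizontal-segments-meet {f = f} {s} {t} σ τ us ut eq syσ nxσ syτ nxτ =
      along-line (unit-intervals-meet (X (lo σ)) (X (lo τ)) us ut (cong proj₁ eq′))
      where
      eq′ : (fromℕ (X (lo σ)) + s , fromℕ (Y (lo σ))) ≡ (fromℕ (X (lo τ)) + t , fromℕ (Y (lo τ)))
      eq′ = trans (sym (lerp-horizontal s syσ nxσ)) (trans eq (lerp-horizontal t syτ nxτ))
      y≡ : Y (lo σ) ≡ Y (lo τ)
      y≡ = fromℕ-injective (cong proj₂ eq′)
      along-line : IntervalsMeet (X (lo σ)) (X (lo τ)) s t → SegmentsMeet σ f s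
      along-line (coincide x≡) =
        inj₁ (same-ends (ends σ) (subst₂ (Ends f) (sym (lattice-injective x≡ y≡))
                                                   (sym (lattice-injective (trans nxσ (trans (cong suc x≡) (sym nxτ)))
                                                                           (trans syσ (trans y≡ (sym syτ)))))
                                                   (ends τ)))
      along-line (at-start-of-y _ touch) =
        inj₂ (inj₂ (lo τ , lo-incident (ends τ) , trans eq (trans (lerp-horizontal t syτ nxτ) (cong₂ _,_ touch refl))))
      along-line (at-start-of-x _ touch) =
        inj₂ (inj₁ (lo σ , lo-incident (ends σ) , trans (lerp-horizontal s syσ nxσ) (cong₂ _,_ touch refl)))

    vertical-segments-meet : ∀ {e f s t} (σ : UnitSegment e) (τ : UnitSegment f) → In[0,1] s → In[0,1] t → point σ s ≡ point τ t →
                             X (hi σ) ≡ X (lo σ) → Y (hi σ) ≡ suc (Y (lo σ)) →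
                             X (hi τ) ≡ X (lo τ) → Y (hi τ) ≡ suc (Y (lo τ)) → SegmentsMeet σ f s
    vertical-segments-meet {f = f} {s} {t} σ τ us ut eq sxσ nyσ sxτ nyτ =
      along-line (unit-intervals-meet (Y (lo σ)) (Y (lo τ)) us ut (cong proj₂ eq′))
      where
      eq′ : (fromℕ (X (lo σ)) , fromℕ (Y (lo σ)) + s) ≡ (fromℕ (X (lo τ)) , fromℕ (Y (lo τ)) + t)
      eq′ = trans (sym (lerp-vertical s sxσ nyσ)) (trans eq (lerp-vertical t sxτ nyτ))
      x≡ : X (lo σ) ≡ X (lo τ)
      x≡ = fromℕ-injective (cong proj₁ eq′)
      along-line : IntervalsMeet (Y (lo σ)) (Y (lo τ)) s t → SegmentsMeet σ f s
      along-line (coincide y≡) =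
        inj₁ (same-ends (ends σ) (subst₂ (Ends f) (sym (lattice-injective x≡ y≡))
                                                   (sym (lattice-injective (trans sxσ (trans x≡ (sym sxτ)))
                                                                           (trans nyσ (trans (cong suc y≡) (sym nyτ)))))
                                                   (ends τ)))
      along-line (at-start-of-y _ touch) =
        inj₂ (inj₂ (lo τ , lo-incident (ends τ) , trans eq (trans (lerp-vertical t sxτ nyτ) (cong₂ _,_ refl touch))))
      along-line (at-start-of-x _ touch) =
        inj₂ (inj₁ (lo σ , lo-incident (ends σ) , trans (lerp-vertical s sxσ nyσ) (cong₂ _,_ refl touch)))

    -- A horizontal and a vertical unit segment can only cross at a lattice point, i.e. at an end.
    segments-meet : ∀ {e f s t} (σ : UnitSegment e) (τ : UnitSegment f) → In[0,1] s → In[0,1] t →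
                    point σ s ≡ point τ t → SegmentsMeet σ f s
    segments-meet {s = s} {t} σ τ us ut eq with step σ | step τ
    ... | inj₁ (syσ , nxσ) | inj₁ (syτ , nxτ) = horizontal-segments-meet σ τ us ut eq syσ nxσ syτ nxτ
    ... | inj₂ (sxσ , nyσ) | inj₂ (sxτ , nyτ) = vertical-segments-meet σ τ us ut eq sxσ nyσ sxτ nyτ
    ... | inj₁ (syσ , nxσ) | inj₂ (sxτ , nyτ) =
      inj₂ (inj₁ (subst (EndOf _) (sym (lerp-horizontal s syσ nxσ))
                    (horizontal-end (X (lo τ)) (ends σ) syσ nxσ us
                                    (cong proj₁ (trans (sym (lerp-horizontal s syσ nxσ)) (trans eq (lerp-vertical t sxτ nyτ)))))))
    ... | inj₂ (sxσ , nyσ) | inj₁ (syτ , nxτ) =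
      inj₂ (inj₁ (subst (EndOf _) (sym (lerp-vertical s sxσ nyσ))
                    (vertical-end (Y (lo τ)) (ends σ) sxσ nyσ us
                                  (cong proj₂ (trans (sym (lerp-vertical s sxσ nyσ)) (trans eq (lerp-horizontal t syτ nxτ)))))))

    EdgesMeet : Edge G → Edge G → ℚ → Set
    EdgesMeet e f s = SameEnds G e f ⊎ (∃ λ w → Incident G w e × Incident G w f × segPt G pos e s ≡ pos w)

    edges-ok : ∀ e f s t → In[0,1] s → In[0,1] t → segPt G pos e s ≡ segPt G pos f t → EdgesMeet e f s
    edges-ok e f s t us ut eq with shape e | shape f
    ... | loop l | _ = at-end-of-e (src G e , inj₁ refl , loop-point e s l)
      where
      at-end-of-e : EndOf e (segPt G pos e s) → EdgesMeet e f s
      at-end-of-e (w , inc , P≡) = inj₂ (w , inc , vertex-ok w f t ut (trans (sym eq) P≡) , P≡)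
    ... | segment σ | loop l = inj₂ (src G f , vertex-ok (src G f) e s us P≡ , inj₁ refl , P≡)
      where
      P≡ : segPt G pos e s ≡ pos (src G f)
      P≡ = trans eq (loop-point f t l)
    ... | segment σ | segment τ =
      let (s′ , us′ , P≡) = traversal σ s us
          (t′ , ut′ , Q≡) = traversal τ t ut
      in conclude P≡ (segments-meet σ τ us′ ut′ (trans (sym P≡) (trans eq Q≡)))
      where
      conclude : ∀ {P} → segPt G pos e s ≡ P → SameEnds G e f ⊎ EndOf e P ⊎ EndOf f P → EdgesMeet e f s
      conclude P≡ (inj₁ same) = inj₁ same
      conclude P≡ (inj₂ (inj₁ (w , inc , Pw))) = inj₂ (w , inc , vertex-ok w f t ut (trans (sym eq) (trans P≡ Pw)) , trans P≡ Pw)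
      conclude P≡ (inj₂ (inj₂ (w , inc , Pw))) = inj₂ (w , vertex-ok w e s us (trans P≡ Pw) , inc , trans P≡ Pw)

    drawing : StraightLineDrawing G
    drawing = record { pos = pos ; pos-inj = pos-injective ; edges-ok = edges-ok ; vertex-ok = vertex-ok }

open LatticeDrawing using (UnitStep; module UnitGrid)

-- Opened only here, so that _+_ and _*_ in LatticeDrawing unambiguously refer to ℚ.
open import Data.Nat using (_+_; _*_; _∸_; _^_; _<?_; _≤?_; _≟_; ⌊_/2⌋)

_++ʷ_ : ∀ {G : Digraph} {u w x k k′} → Walk G u w k → Walk G w x k′ → Walk G u x (k + k′)
nil      ++ʷ ω′ = ω′
cons e ω ++ʷ ω′ = cons e (ω ++ʷ ω′)

<-yes : ∀ {m n} (p : m < n) → (m <? n) ≡ yes p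
<-yes = dec-yes-irr _ ℕP.<-irrelevant

≤-yes : ∀ {m n} (p : m ≤ n) → (m ≤? n) ≡ yes p
≤-yes = dec-yes-irr _ ℕP.≤-irrelevant

≡-yes : ∀ {m n : ℕ} (p : m ≡ n) → (m ≟ n) ≡ yes p
≡-yes = dec-yes-irr _ ℕP.≡-irrelevant

odd : ℕ → Bool
odd zero          = false
odd (suc zero)    = true
odd (suc (suc n)) = odd n

bit : ℕ → ℕ → Bool
bit x zero    = odd x
bit x (suc j) = bit ⌊ x /2⌋ j

bitValue : Bool → ℕ
bitValue true  = 1
bitValue false = 0

fromBits : ∀ {m} → (Fin m → Bool) → ℕ
fromBits {zero}  S = 0
fromBits {suc m} S = bitValue (S Fin.zero) + 2 * fromBits (S ∘ Fin.suc)

fromBits< : ∀ {m} (S : Fin m → Bool) → fromBits S < 2 ^ m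
fromBits< {zero}  S = s≤s z≤n
fromBits< {suc m} S = begin-strict
  bitValue (S Fin.zero) + 2 * fromBits (S ∘ Fin.suc) <⟨ ℕP.+-monoˡ-≤ (2 * fromBits (S ∘ Fin.suc)) (s≤s (bitValue≤1 (S Fin.zero))) ⟩
  2 + 2 * fromBits (S ∘ Fin.suc)                     ≡⟨ sym (ℕP.*-distribˡ-+ 2 1 (fromBits (S ∘ Fin.suc))) ⟩
  2 * suc (fromBits (S ∘ Fin.suc))                   ≤⟨ ℕP.*-monoʳ-≤ 2 (fromBits< (S ∘ Fin.suc)) ⟩
  2 * 2 ^ m                                          ∎
  where
  open ℕP.≤-Reasoning
  bitValue≤1 : ∀ b → bitValue b ≤ 1
  bitValue≤1 true  = s≤s z≤n
  bitValue≤1 false = z≤n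

b+2[1+e] : ∀ b e → b + 2 * suc e ≡ suc (suc (b + 2 * e))
b+2[1+e] = solve 2 (λ b e → b :+ con 2 :* (con 1 :+ e) := con 2 :+ (b :+ con 2 :* e)) refl
  where open +-*-Solver

odd-digit : ∀ b e → odd (bitValue b + 2 * e) ≡ b
odd-digit true  zero    = refl
odd-digit false zero    = refl
odd-digit b     (suc e) rewrite b+2[1+e] (bitValue b) e = odd-digit b e

half-digit : ∀ b e → ⌊ bitValue b + 2 * e /2⌋ ≡ e
half-digit true  zero    = refl
half-digit false zero    = refl
half-digit b     (suc e) rewrite b+2[1+e] (bitValue b) e = cong suc (half-digit b e)

bit-fromBits : ∀ {m} (S : Fin m → Bool) (i : Fin m) → bit (fromBits S) (toℕ i) ≡ S i
bit-fromBits S Fin.zero    = odd-digit (S Fin.zero) (fromBits (S ∘ Fin.suc))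
bit-fromBits S (Fin.suc i) rewrite half-digit (S Fin.zero) (fromBits (S ∘ Fin.suc)) = bit-fromBits (S ∘ Fin.suc) i

module Layout (r : ℕ) where

  -- N roots, one per subset; levels of height H, above every bump; Z columns; the baseline at height R.
  N H Z R : ℕ
  N = 2 ^ r
  H = suc (suc (2 * r))
  Z = suc (N + r)
  R = suc r * H

  -- The cell `cell s z a b o` lies in column z at height b * H + o above the baseline
  -- (s = true) or below it (s = false); lane a = 0 is the column itself, lanes 1 and 2
  -- are the rising and falling legs of the bump between columns z and z + 1.
  record Cell : Set where
    constructor cell
    field
      side : Bool
      column lane level offset : ℕ

  bitCost : ℕ → ℕ → ℕ
  bitCost j z with z <? N
  ... | yes _ = if bit z j then 0 else 2
  ... | no  _ = 1

  -- Summed over the columns z, …, N - 1 the slacks telescope: the upper bumps exceed the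
  -- lower ones by bitCost j z - bitCost j N, which is -1 if bit j of z is set and +1 otherwise.
  bumpSlack : Bool → ℕ → ℕ → ℕ
  bumpSlack true  j z = bitCost j z ∸ bitCost j (suc z)
  bumpSlack false j z = bitCost j (suc z) ∸ bitCost j z

  bumpHeight : Bool → ℕ → ℕ → ℕ
  bumpHeight s j z with z <? N
  ... | yes _ = 2 * (r ∸ suc j) + bumpSlack s j z
  ... | no  _ = 0

  crossCost : Bool → ℕ → ℕ → ℕ
  crossCost s j z = 3 + 2 * bumpHeight s j z

  crossingsCost : Bool → ℕ → ℕ → ℕ → ℕ
  crossingsCost s j z zero    = 0
  crossingsCost s j z (suc k) = crossCost s j z + crossingsCost s j (suc z) k

  climbCost : ℕ → ℕ
  climbCost j = suc j * H

  exitCost : ℕ → ℕ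
  exitCost j = 3 * suc j + (climbCost j ∸ 1)

  rideCost : Bool → ℕ → ℕ → ℕ
  rideCost s j z = crossingsCost s j z (N ∸ z) + exitCost j

  height : ℕ → ℕ → ℕ
  height b o = b * H + o

  -- Level j + 1 is ridden from the root columns to column N + j + 1, where it is left
  -- downwards towards terminal j; both halves end in the same, upper, terminal cell.
  data Step : Cell → Cell → Set where
    root-up       : ∀ {z} → z < N → Step (cell true z 0 0 0) (cell true z 0 0 1)
    root-down     : ∀ {z} → z < N → Step (cell true z 0 0 0) (cell false z 0 0 1)
    climb         : ∀ {s z b o} → z < N → b < r → 0 < height b o → suc o < H →
                    Step (cell s z 0 b o) (cell s z 0 b (suc o))
    climb-band    : ∀ {s z b o} → z < N → b < r → suc o ≡ H → Step (cell s z 0 b o) (cell s z 0 (suc b) 0)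
    bump-enter    : ∀ {s z j} → z ≤ N + j → Step (cell s z 0 (suc j) 0) (cell s z 1 (suc j) 0)
    bump-rise     : ∀ {s z j o} → o < bumpHeight s j z → Step (cell s z 1 (suc j) o) (cell s z 1 (suc j) (suc o))
    bump-cross    : ∀ {s z j o} → z ≤ N + j → o ≡ bumpHeight s j z → Step (cell s z 1 (suc j) o) (cell s z 2 (suc j) o)
    bump-fall     : ∀ {s z j o} → suc o ≤ bumpHeight s j z → Step (cell s z 2 (suc j) (suc o)) (cell s z 2 (suc j) o)
    bump-leave    : ∀ {s z j} → z ≤ N + j → Step (cell s z 2 (suc j) 0) (cell s (suc z) 0 (suc j) 0)
    descend-band  : ∀ {s z b} → N ≤ z → suc b ≤ z ∸ N → Step (cell s z 0 (suc b) 0) (cell s z 0 b (suc (2 * r)))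
    descend       : ∀ {s z b o} → N ≤ z → b < z ∸ N → Step (cell s z 0 b (suc (suc o))) (cell s z 0 b (suc o))
    descend-floor : ∀ {s z b} → N ≤ z → suc b < z ∸ N → Step (cell s z 0 (suc b) 1) (cell s z 0 (suc b) 0)
    arrive        : ∀ {s z} → N ≤ z → 0 < z ∸ N → Step (cell s z 0 0 1) (cell true z 0 0 0)

  height-suc : ∀ b o → height b (suc o) ≡ suc (height b o)
  height-suc b o = ℕP.+-suc (b * H) o

  0<height-suc : ∀ b o → 0 < height b (suc o)
  0<height-suc b o = subst (0 <_) (sym (height-suc b o)) (s≤s z≤n)

  0<height-level : ∀ j o → 0 < height (suc j) o
  0<height-level j o = ℕP.<-≤-trans (s≤s z≤n) (ℕP.≤-trans (ℕP.m≤m+n H (j * H)) (ℕP.m≤m+n (suc j * H) o))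

  0<height-top : ∀ b o → suc o ≡ H → 0 < height b o
  0<height-top b o e = ℕP.<-≤-trans (subst (0 <_) (sym (ℕP.suc-injective e)) (s≤s z≤n)) (ℕP.m≤n+m o (b * H))

  height-carry : ∀ b o → suc o ≡ H → height (suc b) 0 ≡ suc (height b o)
  height-carry b o e = trans (ℕP.+-identityʳ (suc b * H)) (trans (ℕP.+-comm H (b * H)) (trans (cong (b * H +_) (sym e)) (ℕP.+-suc (b * H) o)))

  Slot : Cell → Set
  Slot c = Maybe (Σ Cell (Step c))

  columnSlot : ∀ s z b o → Slot (cell s z 0 b o)
  columnSlot s z b o with z <? N
  ... | yes zN with b <? r | 0 <? height b o
  ...   | yes br | yes tp with suc o <? H
  ...     | yes oH = just (_ , climb zN br tp oH)
  ...     | no _ with suc o ≟ H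
  ...       | yes oH = just (_ , climb-band zN br oH)
  ...       | no _ = nothing
  columnSlot s z b o | yes zN | _ | _ = nothing
  columnSlot s z (suc b) zero | no zN with z ≤? N + b
  ... | yes p = just (_ , bump-enter p)
  ... | no p = just (_ , descend-band (ℕP.≮⇒≥ zN) (beyond p))
    where
    beyond : ¬ z ≤ N + b → suc b ≤ z ∸ N
    beyond p = ℕP.+-cancelˡ-≤ N _ _ (subst (N + suc b ≤_) (sym (ℕP.m+[n∸m]≡n (ℕP.≮⇒≥ zN)))
                 (subst (_≤ z) (sym (ℕP.+-suc N b)) (ℕP.≰⇒> p)))
  columnSlot s z zero (suc zero) | no zN with 0 <? z ∸ N
  ... | yes p = just (_ , arrive (ℕP.≮⇒≥ zN) p)
  ... | no _ = nothing
  columnSlot s z (suc b) (suc zero) | no zN with suc b <? z ∸ N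
  ... | yes p = just (_ , descend-floor (ℕP.≮⇒≥ zN) p)
  ... | no _ = nothing
  columnSlot s z b (suc (suc o)) | no zN with b <? z ∸ N
  ... | yes p = just (_ , descend (ℕP.≮⇒≥ zN) p)
  ... | no _ = nothing
  columnSlot s z zero zero | no zN = nothing

  risingSlot : ∀ s z j o → Slot (cell s z 1 (suc j) o)
  risingSlot s z j o with o <? bumpHeight s j z
  ... | yes p = just (_ , bump-rise p)
  ... | no _ with z ≤? N + j | o ≟ bumpHeight s j z
  ...   | yes p | yes q = just (_ , bump-cross p q)
  ...   | _ | _ = nothing

  fallingSlot : ∀ s z j o → Slot (cell s z 2 (suc j) o)
  fallingSlot s z j zero with z ≤? N + j
  ... | yes p = just (_ , bump-leave p)
  ... | no _ = nothing
  fallingSlot s z j (suc o) with suc o ≤? bumpHeight s j z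
  ... | yes p = just (_ , bump-fall p)
  ... | no _ = nothing

  primary : ∀ c → Slot c
  primary (cell true z 0 0 0) with z <? N
  ... | yes p = just (_ , root-up p)
  ... | no _ = nothing
  primary (cell false z a 0 0) = nothing
  primary (cell s z 0 0 (suc o)) = columnSlot s z 0 (suc o)
  primary (cell s z 0 (suc b) o) = columnSlot s z (suc b) o
  primary (cell true z (suc a) 0 0) = nothing
  primary (cell s z 1 (suc j) o) = risingSlot s z j o
  primary (cell s z 2 (suc j) o) = fallingSlot s z j o
  primary (cell s z 1 0 (suc o)) = nothing
  primary (cell s z 2 0 (suc o)) = nothing
  primary (cell s z (suc (suc (suc a))) b o) = nothing

  secondary : ∀ c → Slot c
  secondary (cell true z 0 0 0) with z <? N
  ... | yes p = just (_ , root-down p)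
  ... | no _ = nothing
  secondary (cell s z 0 (suc j) 0) with z <? N
  ... | yes p = just (_ , bump-enter (ℕP.≤-trans (ℕP.<⇒≤ p) (ℕP.m≤m+n N j)))
  ... | no _ = nothing
  secondary _ = nothing

  beyond-level : ∀ {z b} → N ≤ z → suc b ≤ z ∸ N → ¬ z ≤ N + b
  beyond-level {z} N≤z m q =
    ℕP.<-irrefl refl (ℕP.<-≤-trans (ℕP.+-monoʳ-< N m) (ℕP.≤-trans (ℕP.≤-reflexive (ℕP.m+[n∸m]≡n N≤z)) q))

  primary-column : ∀ s z b o → 0 < height b o → primary (cell s z 0 b o) ≡ columnSlot s z b o
  primary-column true  z zero    (suc o) _ = refl
  primary-column false z zero    (suc o) _ = refl
  primary-column true  z (suc b) o       _ = refl
  primary-column false z (suc b) o       _ = refl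

  primary-rising : ∀ s z j o → primary (cell s z 1 (suc j) o) ≡ risingSlot s z j o
  primary-rising true  z j o = refl
  primary-rising false z j o = refl

  primary-falling : ∀ s z j o → primary (cell s z 2 (suc j) o) ≡ fallingSlot s z j o
  primary-falling true  z j o = refl
  primary-falling false z j o = refl

  Primary Secondary : Cell → Cell → Set
  Primary   c c′ = map proj₁ (primary c) ≡ just c′
  Secondary c c′ = map proj₁ (secondary c) ≡ just c′

  primary-climb : ∀ {s z b o} → z < N → b < r → 0 < height b o → suc o < H → Primary (cell s z 0 b o) (cell s z 0 b (suc o))
  primary-climb {s} {z} {b} {o} zN br tp oH rewrite primary-column s z b o tp | <-yes zN | <-yes br | <-yes tp | <-yes oH = refl

  primary-climb-band : ∀ {s z b o} → z < N → b < r → suc o ≡ H → Primary (cell s z 0 b o) (cell s z 0 (suc b) 0)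
  primary-climb-band {s} {z} {b} {o} zN br oH
    rewrite primary-column s z b o (0<height-top b o oH) | <-yes zN | <-yes br | <-yes (0<height-top b o oH)
          | dec-no (suc o <? H) (ℕP.<-irrefl oH) | ≡-yes oH = refl

  primary-bump-enter : ∀ {s z j} → N ≤ z → z ≤ N + j → Primary (cell s z 0 (suc j) 0) (cell s z 1 (suc j) 0)
  primary-bump-enter {s} {z} {j} N≤z bd
    rewrite primary-column s z (suc j) 0 (0<height-level j 0) | dec-no (z <? N) (ℕP.≤⇒≯ N≤z) | ≤-yes bd = refl

  primary-descend-band : ∀ {s z b} → N ≤ z → suc b ≤ z ∸ N → Primary (cell s z 0 (suc b) 0) (cell s z 0 b (suc (2 * r)))
  primary-descend-band {s} {z} {b} N≤z m
    rewrite primary-column s z (suc b) 0 (0<height-level b 0) | dec-no (z <? N) (ℕP.≤⇒≯ N≤z)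
          | dec-no (z ≤? N + b) (beyond-level N≤z m) = refl

  primary-descend : ∀ {s z b o} → N ≤ z → b < z ∸ N → Primary (cell s z 0 b (suc (suc o))) (cell s z 0 b (suc o))
  primary-descend {s} {z} {zero}  {o} N≤z m
    rewrite primary-column s z 0 (suc (suc o)) (s≤s z≤n) | dec-no (z <? N) (ℕP.≤⇒≯ N≤z) | <-yes m = refl
  primary-descend {s} {z} {suc b} {o} N≤z m
    rewrite primary-column s z (suc b) (suc (suc o)) (0<height-level b _) | dec-no (z <? N) (ℕP.≤⇒≯ N≤z) | <-yes m = refl

  primary-descend-floor : ∀ {s z b} → N ≤ z → suc b < z ∸ N → Primary (cell s z 0 (suc b) 1) (cell s z 0 (suc b) 0)
  primary-descend-floor {s} {z} {b} N≤z m
    rewrite primary-column s z (suc b) 1 (0<height-level b 1) | dec-no (z <? N) (ℕP.≤⇒≯ N≤z) | <-yes m = refl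

  primary-arrive : ∀ {s z} → N ≤ z → 0 < z ∸ N → Primary (cell s z 0 0 1) (cell true z 0 0 0)
  primary-arrive {s} {z} N≤z m rewrite primary-column s z 0 1 (s≤s z≤n) | dec-no (z <? N) (ℕP.≤⇒≯ N≤z) | <-yes m = refl

  primary-bump-rise : ∀ {s z j o} → o < bumpHeight s j z → Primary (cell s z 1 (suc j) o) (cell s z 1 (suc j) (suc o))
  primary-bump-rise {s} {z} {j} {o} p rewrite primary-rising s z j o | <-yes p = refl

  primary-bump-cross : ∀ {s z j o} → z ≤ N + j → o ≡ bumpHeight s j z → Primary (cell s z 1 (suc j) o) (cell s z 2 (suc j) o)
  primary-bump-cross {s} {z} {j} {o} bd e
    rewrite primary-rising s z j o | dec-no (o <? bumpHeight s j z) (ℕP.<-irrefl e) | ≤-yes bd | ≡-yes e = refl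

  primary-bump-leave : ∀ {s z j} → z ≤ N + j → Primary (cell s z 2 (suc j) 0) (cell s (suc z) 0 (suc j) 0)
  primary-bump-leave {s} {z} {j} bd rewrite primary-falling s z j 0 | ≤-yes bd = refl

  primary-bump-fall : ∀ {s z j o} → suc o ≤ bumpHeight s j z → Primary (cell s z 2 (suc j) (suc o)) (cell s z 2 (suc j) o)
  primary-bump-fall {s} {z} {j} {o} p rewrite primary-falling s z j (suc o) | ≤-yes p = refl

  primary-root : ∀ {z} → z < N → Primary (cell true z 0 0 0) (cell true z 0 0 1)
  primary-root p rewrite <-yes p = refl

  secondary-root : ∀ {z} → z < N → Secondary (cell true z 0 0 0) (cell false z 0 0 1)
  secondary-root p rewrite <-yes p = refl

  secondary-junction : ∀ {s z j} → z < N → Secondary (cell s z 0 (suc j) 0) (cell s z 1 (suc j) 0)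
  secondary-junction {true}  p rewrite <-yes p = refl
  secondary-junction {false} p rewrite <-yes p = refl

  slot-of-step : ∀ {c c′} → Step c c′ → Primary c c′ ⊎ Secondary c c′
  slot-of-step (root-up zN)          = inj₁ (primary-root zN)
  slot-of-step (root-down zN)        = inj₂ (secondary-root zN)
  slot-of-step (climb zN br tp oH)   = inj₁ (primary-climb zN br tp oH)
  slot-of-step (climb-band zN br oH) = inj₁ (primary-climb-band zN br oH)
  slot-of-step (bump-enter {z = z} bd) with ℕP.<-≤-connex z N
  ... | inj₁ z<N                     = inj₂ (secondary-junction z<N)
  ... | inj₂ N≤z                     = inj₁ (primary-bump-enter N≤z bd)
  slot-of-step (bump-rise p)         = inj₁ (primary-bump-rise p)
  slot-of-step (bump-cross bd e)     = inj₁ (primary-bump-cross bd e)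
  slot-of-step (bump-fall p)         = inj₁ (primary-bump-fall p)
  slot-of-step (bump-leave bd)       = inj₁ (primary-bump-leave bd)
  slot-of-step (descend-band N≤z m)  = inj₁ (primary-descend-band N≤z m)
  slot-of-step (descend N≤z m)       = inj₁ (primary-descend N≤z m)
  slot-of-step (descend-floor N≤z m) = inj₁ (primary-descend-floor N≤z m)
  slot-of-step (arrive {s} N≤z m)    = inj₁ (primary-arrive {s} N≤z m)

  InBounds : Cell → Set
  InBounds (cell s z a b o) = z < Z × a < 3 × b < suc r × o < H

  -- Lower cells at height 0 would coincide with upper ones.
  cellX : Cell → ℕ
  cellX (cell true  z a b       o)       = z * 3 + a
  cellX (cell false z a zero    zero)    = 3 * Z + (z * 3 + a)
  cellX (cell false z a zero    (suc o)) = z * 3 + a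
  cellX (cell false z a (suc b) o)       = z * 3 + a

  cellY : Cell → ℕ
  cellY (cell true  z a b o) = R + height b o
  cellY (cell false z a b o) = R ∸ height b o

  UnitEdge : Cell → Cell → Set
  UnitEdge c c′ = UnitStep cellX cellY c c′ ⊎ UnitStep cellX cellY c′ c

  height<R : ∀ {b o} → b < suc r → o < H → height b o < R
  height<R {b} {o} pb po =
    ℕP.≤-trans (ℕP.+-monoʳ-< (b * H) po) (ℕP.≤-trans (ℕP.≤-reflexive (ℕP.+-comm (b * H) H)) (ℕP.*-monoˡ-≤ H pb))

  cellX-lower : ∀ z a b o → 0 < height b o → cellX (cell false z a b o) ≡ z * 3 + a
  cellX-lower z a zero    (suc o) _ = refl
  cellX-lower z a (suc b) o       _ = refl

  R∸h≡1+R∸1+h : ∀ {h} → suc h ≤ R → R ∸ h ≡ suc (R ∸ suc h)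
  R∸h≡1+R∸1+h p = ℕP.+-∸-assoc 1 p

  unit-rise : ∀ s {z a b o b′ o′} → height b′ o′ ≡ suc (height b o) → height b′ o′ < R → 0 < height b o →
              UnitEdge (cell s z a b o) (cell s z a b′ o′)
  unit-rise true e _ _ = inj₁ (inj₂ (refl , trans (cong (R +_) e) (ℕP.+-suc R _)))
  unit-rise false {z} {a} {b} {o} {b′} {o′} e lt pos =
    inj₂ (inj₂ (trans (cellX-lower z a b o pos) (sym (cellX-lower z a b′ o′ (subst (0 <_) (sym e) (s≤s z≤n)))) ,
                trans (R∸h≡1+R∸1+h (subst (_≤ R) e (ℕP.<⇒≤ lt))) (cong (λ w → suc (R ∸ w)) (sym e))))

  unit-fall : ∀ s {z a b o b′ o′} → height b o ≡ suc (height b′ o′) → height b o < R → 0 < height b′ o′ →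
              UnitEdge (cell s z a b o) (cell s z a b′ o′)
  unit-fall s e lt pos with unit-rise s e lt pos
  ... | inj₁ step = inj₂ step
  ... | inj₂ step = inj₁ step

  unit-next-lane : ∀ s {z a b o} → 0 < height b o → UnitEdge (cell s z a b o) (cell s z (suc a) b o)
  unit-next-lane true {z} {a} _ = inj₁ (inj₁ (refl , ℕP.+-suc (z * 3) a))
  unit-next-lane false {z} {a} {b} {o} p =
    inj₁ (inj₁ (refl , trans (cellX-lower z (suc a) b o p) (trans (ℕP.+-suc (z * 3) a) (cong suc (sym (cellX-lower z a b o p))))))

  next-column-x : ∀ z → suc z * 3 + 0 ≡ suc (z * 3 + 2)
  next-column-x z = trans (ℕP.+-identityʳ (suc z * 3)) (trans (ℕP.+-comm 3 (z * 3)) (ℕP.+-suc (z * 3) 2))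

  unit-next-column : ∀ s {z b o} → 0 < height b o → UnitEdge (cell s z 2 b o) (cell s (suc z) 0 b o)
  unit-next-column true {z} _ = inj₁ (inj₁ (refl , next-column-x z))
  unit-next-column false {z} {b} {o} p =
    inj₁ (inj₁ (refl , trans (cellX-lower (suc z) 0 b o p) (trans (next-column-x z) (cong suc (sym (cellX-lower z 2 b o p))))))

  step-unit : ∀ {c c′} → Step c c′ → InBounds c → InBounds c′ → UnitEdge c c′
  step-unit (root-up p) _ _ = inj₁ (inj₂ (refl , ℕP.+-suc R 0))
  step-unit (root-down p) _ _ = inj₂ (inj₂ (refl , trans (ℕP.+-identityʳ R) (R∸h≡1+R∸1+h (s≤s z≤n))))
  step-unit {cell s z 0 b o} (climb _ _ tp _) _ (_ , _ , pb , po) = unit-rise s (height-suc b o) (height<R pb po) tp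
  step-unit {cell s z 0 b o} (climb-band _ _ oH) _ (_ , _ , pb , po) = unit-rise s (height-carry b o oH) (height<R pb po) (0<height-top b o oH)
  step-unit {cell s z 0 (suc j) 0} (bump-enter _) _ _ = unit-next-lane s (0<height-level j 0)
  step-unit {cell s z 1 (suc j) o} (bump-rise _) _ (_ , _ , pb , po) = unit-rise s (height-suc (suc j) o) (height<R pb po) (0<height-level j o)
  step-unit {cell s z 1 (suc j) o} (bump-cross _ _) _ _ = unit-next-lane s (0<height-level j o)
  step-unit {cell s z 2 (suc j) (suc o)} (bump-fall _) (_ , _ , pb , po) _ = unit-fall s (height-suc (suc j) o) (height<R pb po) (0<height-level j o)
  step-unit {cell s z 2 (suc j) 0} (bump-leave _) _ _ = unit-next-column s (0<height-level j 0)
  step-unit {cell s z 0 (suc b) 0} (descend-band _ _) (_ , _ , pb , po) _ =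
    unit-fall s (height-carry b (suc (2 * r)) refl) (height<R pb po) (0<height-top b (suc (2 * r)) refl)
  step-unit {cell s z 0 b (suc (suc o))} (descend _ _) (_ , _ , pb , po) _ = unit-fall s (height-suc b (suc o)) (height<R pb po) (0<height-suc b o)
  step-unit {cell s z 0 (suc b) 1} (descend-floor _ _) (_ , _ , pb , po) _ = unit-fall s (height-suc (suc b) 0) (height<R pb po) (0<height-level b 0)
  step-unit {cell true z 0 0 1} (arrive _ _) _ _ = inj₂ (inj₂ (refl , ℕP.+-suc R 0))
  step-unit {cell false z 0 0 1} (arrive _ _) _ _ = inj₁ (inj₂ (refl , trans (ℕP.+-identityʳ R) (R∸h≡1+R∸1+h (s≤s z≤n))))

  divmod-unique : ∀ K q q′ a a′ → a < K → a′ < K → q * K + a ≡ q′ * K + a′ → q ≡ q′ × a ≡ a′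
  divmod-unique K zero zero a a′ p p′ eq = refl , eq
  divmod-unique K zero (suc q′) a a′ p p′ eq =
    contradiction (ℕP.<-≤-trans p (subst (K ≤_) (sym eq) (ℕP.≤-trans (ℕP.m≤m+n K (q′ * K)) (ℕP.m≤m+n _ a′)))) (ℕP.<-irrefl refl)
  divmod-unique K (suc q) zero a a′ p p′ eq =
    contradiction (ℕP.<-≤-trans p′ (subst (K ≤_) eq (ℕP.≤-trans (ℕP.m≤m+n K (q * K)) (ℕP.m≤m+n _ a)))) (ℕP.<-irrefl refl)
  divmod-unique K (suc q) (suc q′) a a′ p p′ eq
    with divmod-unique K q q′ a a′ p p′
           (ℕP.+-cancelˡ-≡ K _ _ (trans (sym (ℕP.+-assoc K (q * K) a)) (trans eq (ℕP.+-assoc K (q′ * K) a′))))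
  ... | refl , a≡a′ = refl , a≡a′

  cell-from-coordinates : ∀ {s z a b o z′ a′ b′ o′} → a < 3 → a′ < 3 → o < H → o′ < H →
                          z * 3 + a ≡ z′ * 3 + a′ → height b o ≡ height b′ o′ → cell s z a b o ≡ cell s z′ a′ b′ o′
  cell-from-coordinates {z = z} {a} {b} {o} {z′} {a′} {b′} {o′} pa pa′ po po′ ex eh
    with divmod-unique 3 z z′ a a′ pa pa′ ex | divmod-unique H b b′ o o′ po po′ eh
  ... | refl , refl | refl , refl = refl

  parked-x : ∀ {z a w} → z < Z → a < 3 → z * 3 + a ≢ 3 * Z + w
  parked-x {z} {a} pz pa eq = ℕP.<-irrefl refl (ℕP.<-≤-trans x<3Z (subst (3 * Z ≤_) (sym eq) (ℕP.m≤m+n (3 * Z) _)))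
    where
    x<3Z : z * 3 + a < 3 * Z
    x<3Z = ℕP.<-≤-trans (ℕP.+-monoʳ-< (z * 3) pa)
             (ℕP.≤-trans (ℕP.≤-reflexive (ℕP.+-comm (z * 3) 3)) (subst (suc z * 3 ≤_) (ℕP.*-comm Z 3) (ℕP.*-monoˡ-≤ 3 pz)))

  above≢below : ∀ {h h′} → 0 < h′ → h′ ≤ R → R + h ≢ R ∸ h′
  above≢below {h} {h′} p q eq =
    ℕP.<-irrefl refl (ℕP.<-≤-trans (ℕP.∸-monoʳ-< {R} {h′} {0} p q) (subst (R ≤_) eq (ℕP.m≤m+n R h)))

  data Region : Cell → Set where
    upper  : ∀ {z a b o} → Region (cell true z a b o)
    parked : ∀ {z a} → Region (cell false z a 0 0)
    lower  : ∀ {z a b o} → 0 < height b o → Region (cell false z a b o)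

  region : ∀ c → Region c
  region (cell true  _ _ _       _)       = upper
  region (cell false _ _ zero    zero)    = parked
  region (cell false _ _ zero    (suc o)) = lower (s≤s z≤n)
  region (cell false _ _ (suc b) o)       = lower (0<height-level b o)

  region-lattice-injective : ∀ {c c′} → Region c → Region c′ → InBounds c → InBounds c′ →
                             cellX c ≡ cellX c′ → cellY c ≡ cellY c′ → c ≡ c′
  region-lattice-injective upper upper (_ , pa , _ , po) (_ , pa′ , _ , po′) ex ey =
    cell-from-coordinates pa pa′ po po′ ex (ℕP.+-cancelˡ-≡ R _ _ ey)
  region-lattice-injective parked parked (_ , pa , _) (_ , pa′ , _) ex ey =
    cell-from-coordinates pa pa′ (s≤s z≤n) (s≤s z≤n) (ℕP.+-cancelˡ-≡ (3 * Z) _ _ ex) refl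
  region-lattice-injective (lower {z} {a} {b} {o} h) (lower {z′} {a′} {b′} {o′} h′) (_ , pa , pb , po) (_ , pa′ , pb′ , po′) ex ey =
    cell-from-coordinates pa pa′ po po′ (trans (sym (cellX-lower z a b o h)) (trans ex (cellX-lower z′ a′ b′ o′ h′)))
                          (ℕP.∸-cancelˡ-≡ (ℕP.<⇒≤ (height<R pb po)) (ℕP.<⇒≤ (height<R pb′ po′)) ey)
  region-lattice-injective upper parked (pz , pa , _) _ ex ey = contradiction ex (parked-x pz pa)
  region-lattice-injective parked upper _ (pz′ , pa′ , _) ex ey = contradiction (sym ex) (parked-x pz′ pa′)
  region-lattice-injective upper (lower h) _ (_ , _ , pb′ , po′) ex ey = contradiction ey (above≢below h (ℕP.<⇒≤ (height<R pb′ po′)))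
  region-lattice-injective (lower h) upper (_ , _ , pb , po) _ ex ey = contradiction (sym ey) (above≢below h (ℕP.<⇒≤ (height<R pb po)))
  region-lattice-injective parked (lower h) _ (_ , _ , pb′ , po′) ex ey =
    contradiction (trans (ℕP.+-identityʳ R) ey) (above≢below h (ℕP.<⇒≤ (height<R pb′ po′)))
  region-lattice-injective (lower h) parked (_ , _ , pb , po) _ ex ey =
    contradiction (trans (ℕP.+-identityʳ R) (sym ey)) (above≢below h (ℕP.<⇒≤ (height<R pb po)))

  cell-lattice-injective : ∀ {c c′} → InBounds c → InBounds c′ → cellX c ≡ cellX c′ → cellY c ≡ cellY c′ → c ≡ c′
  cell-lattice-injective {c} {c′} = region-lattice-injective (region c) (region c′)

module Potential (r : ℕ) where

  open Layout r

  -- Φ s j c is a lower bound on the distance from c to the cell `cell s (N + suc j) 0 0 1`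
  -- from which terminal j is entered on side s (nothing where that cell is unreachable);
  -- along the designed route (climb, ride, exit) it is exact.
  junctionΦ : Bool → ℕ → ℕ → ℕ → Maybe ℕ
  junctionΦ s j z j′ with N ≤? z
  ... | no _ with j′ ≤? j
  ...   | yes _ = just ((j ∸ j′) * H + rideCost s j z)
  ...   | no _ = nothing
  junctionΦ s j z j′ | yes _ with j′ ≟ j | z ≤? N + suc j
  ...   | yes _ | yes _ = just (3 * (N + suc j ∸ z) + (climbCost j ∸ 1))
  ...   | yes _ | no _ = nothing
  ...   | no _ | _ = nothing

  columnΦ : Bool → ℕ → ℕ → ℕ → ℕ → Maybe ℕ
  columnΦ s j z b o with z <? N
  ... | yes _ with height b o ≤? climbCost j
  ...   | yes _ = just (climbCost j ∸ height b o + rideCost s j z)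
  ...   | no _ = nothing
  columnΦ s j z b o | no _ with z ∸ N ≟ suc j
  ...   | yes _ with height b o ≤? climbCost j
  ...     | yes _ = just (height b o ∸ 1)
  ...     | no _ = nothing
  columnΦ s j z b zero | no _ | no _ with b ≟ suc j
  ...     | yes _ = junctionΦ s j z j
  ...     | no _ = nothing
  columnΦ s j z b (suc o) | no _ | no _ = nothing

  bumpRemaining : ℕ → ℕ → ℕ → ℕ
  bumpRemaining 1 h o = (2 + 2 * h) ∸ o
  bumpRemaining _ h o = suc o

  bumpΦ : Bool → ℕ → ℕ → ℕ → ℕ → ℕ → Maybe ℕ
  bumpΦ s j z a j′ o with z ≤? N + j′ | o ≤? bumpHeight s j′ z
  ... | yes _ | yes _ = map (bumpRemaining a (bumpHeight s j′ z) o +_) (junctionΦ s j (suc z) j′)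
  ... | _ | _ = nothing

  elevatedΦ : Bool → ℕ → ℕ → ℕ → ℕ → ℕ → Maybe ℕ
  elevatedΦ s j z 0 b o = columnΦ s j z b o
  elevatedΦ s j z 1 (suc j′) o = bumpΦ s j z 1 j′ o
  elevatedΦ s j z 2 (suc j′) o = bumpΦ s j z 2 j′ o
  elevatedΦ s j z _ _ o = nothing

  rootΦ : Bool → ℕ → ℕ → ℕ → Maybe ℕ
  rootΦ s j z (suc a) = nothing
  rootΦ s j z 0 with z <? N
  ... | yes _ = just (climbCost j + rideCost s j z)
  ... | no _ = nothing

  Φ : Bool → ℕ → Cell → Maybe ℕ
  Φ s j (cell true  z a 0 0)       = rootΦ s j z a
  Φ s j (cell false z a 0 0)       = nothing
  Φ s j (cell s′ z a 0 (suc o))    = if does (s BoolP.≟ s′) then elevatedΦ s j z a 0 (suc o) else nothing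
  Φ s j (cell s′ z a (suc b) o)    = if does (s BoolP.≟ s′) then elevatedΦ s j z a (suc b) o else nothing

  nothing≢just : ∀ {x : ℕ} → nothing ≢ just x
  nothing≢just ()

  bumpHeight-inside : ∀ s j z → z < N → bumpHeight s j z ≡ 2 * (r ∸ suc j) + bumpSlack s j z
  bumpHeight-inside s j z p rewrite <-yes p = refl

  bumpHeight-beyond : ∀ s j z → N ≤ z → bumpHeight s j z ≡ 0
  bumpHeight-beyond s j z p rewrite dec-no (z <? N) (ℕP.≤⇒≯ p) = refl

  junction-inside : ∀ s j z j′ → z < N → j′ ≤ j → junctionΦ s j z j′ ≡ just ((j ∸ j′) * H + rideCost s j z)
  junction-inside s j z j′ p q rewrite dec-no (N ≤? z) (ℕP.<⇒≱ p) | ≤-yes q = refl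

  junction-inside-above : ∀ s j z j′ → z < N → ¬ j′ ≤ j → junctionΦ s j z j′ ≡ nothing
  junction-inside-above s j z j′ p q rewrite dec-no (N ≤? z) (ℕP.<⇒≱ p) | dec-no (j′ ≤? j) q = refl

  junction-exit : ∀ s j z → N ≤ z → z ≤ N + suc j → junctionΦ s j z j ≡ just (3 * (N + suc j ∸ z) + (climbCost j ∸ 1))
  junction-exit s j z p q rewrite ≤-yes p | ≡-yes (refl {x = j}) | ≤-yes q = refl

  junction-beyond-other : ∀ s j z j′ → N ≤ z → j′ ≢ j → junctionΦ s j z j′ ≡ nothing
  junction-beyond-other s j z j′ p q rewrite ≤-yes p | dec-no (j′ ≟ j) q = refl

  junction-beyond-far : ∀ s j z j′ → N ≤ z → ¬ z ≤ N + suc j → junctionΦ s j z j′ ≡ nothing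
  junction-beyond-far s j z j′ p q with j′ ≟ j
  ... | yes refl rewrite ≤-yes p | ≡-yes (refl {x = j}) | dec-no (z ≤? N + suc j) q = refl
  ... | no j′≢j = junction-beyond-other s j z j′ p j′≢j

  column-inside : ∀ s j z b o → z < N → height b o ≤ climbCost j → columnΦ s j z b o ≡ just (climbCost j ∸ height b o + rideCost s j z)
  column-inside s j z b o p q rewrite <-yes p | ≤-yes q = refl

  column-inside-above : ∀ s j z b o → z < N → ¬ height b o ≤ climbCost j → columnΦ s j z b o ≡ nothing
  column-inside-above s j z b o p q rewrite <-yes p | dec-no (height b o ≤? climbCost j) q = refl

  column-exit : ∀ s j z b o → N ≤ z → z ∸ N ≡ suc j → height b o ≤ climbCost j → columnΦ s j z b o ≡ just (height b o ∸ 1)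
  column-exit s j z b o p e q rewrite dec-no (z <? N) (ℕP.≤⇒≯ p) | ≡-yes e | ≤-yes q = refl

  column-exit-above : ∀ s j z b o → N ≤ z → z ∸ N ≡ suc j → ¬ height b o ≤ climbCost j → columnΦ s j z b o ≡ nothing
  column-exit-above s j z b o p e q rewrite dec-no (z <? N) (ℕP.≤⇒≯ p) | ≡-yes e | dec-no (height b o ≤? climbCost j) q = refl

  column-junction : ∀ s j z → N ≤ z → z ∸ N ≢ suc j → columnΦ s j z (suc j) 0 ≡ junctionΦ s j z j
  column-junction s j z p e rewrite dec-no (z <? N) (ℕP.≤⇒≯ p) | dec-no (z ∸ N ≟ suc j) e | ≡-yes (refl {x = suc j}) = refl

  column-beyond-other : ∀ s j z b → N ≤ z → z ∸ N ≢ suc j → b ≢ suc j → columnΦ s j z b 0 ≡ nothing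
  column-beyond-other s j z b p e ne rewrite dec-no (z <? N) (ℕP.≤⇒≯ p) | dec-no (z ∸ N ≟ suc j) e | dec-no (b ≟ suc j) ne = refl

  column-beyond-offset : ∀ s j z b o → N ≤ z → z ∸ N ≢ suc j → columnΦ s j z b (suc o) ≡ nothing
  column-beyond-offset s j z b o p e rewrite dec-no (z <? N) (ℕP.≤⇒≯ p) | dec-no (z ∸ N ≟ suc j) e = refl

  bump-within : ∀ s j z a j′ o → z ≤ N + j′ → o ≤ bumpHeight s j′ z →
                bumpΦ s j z a j′ o ≡ map (bumpRemaining a (bumpHeight s j′ z) o +_) (junctionΦ s j (suc z) j′)
  bump-within s j z a j′ o p q rewrite ≤-yes p | ≤-yes q = refl

  bump-inversion : ∀ s j z a j′ o {β} → bumpΦ s j z a j′ o ≡ just β →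
                   z ≤ N + j′ × o ≤ bumpHeight s j′ z ×
                   ∃ λ β′ → junctionΦ s j (suc z) j′ ≡ just β′ × bumpRemaining a (bumpHeight s j′ z) o + β′ ≡ β
  bump-inversion s j z a j′ o eq with z ≤? N + j′ | o ≤? bumpHeight s j′ z
  ... | yes p | yes q with junctionΦ s j (suc z) j′
  ...   | just β′ = p , q , β′ , refl , just-injective eq

  root-Φ : ∀ s j z → z < N → rootΦ s j z 0 ≡ just (climbCost j + rideCost s j z)
  root-Φ s j z p rewrite <-yes p = refl

  root-beyond : ∀ s j z → N ≤ z → rootΦ s j z 0 ≡ nothing
  root-beyond s j z p rewrite dec-no (z <? N) (ℕP.≤⇒≯ p) = refl

  junction-above : ∀ s j z j′ → ¬ j′ ≤ j → junctionΦ s j z j′ ≡ nothing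
  junction-above s j z j′ j′≰j with ℕP.<-≤-connex z N
  ... | inj₁ zN = junction-inside-above s j z j′ zN j′≰j
  ... | inj₂ zN = junction-beyond-other s j z j′ zN (λ j′≡j → j′≰j (ℕP.≤-reflexive j′≡j))

  rideCost-step : ∀ s j z → z < N → rideCost s j z ≡ crossCost s j z + rideCost s j (suc z)
  rideCost-step s j z p rewrite ℕP.+-∸-assoc 1 p = ℕP.+-assoc (crossCost s j z) _ (exitCost j)

  rideCost-N : ∀ s j → rideCost s j N ≡ exitCost j
  rideCost-N s j rewrite ℕP.n∸n≡0 N = refl

  bitCost≤2 : ∀ j z → bitCost j z ≤ 2
  bitCost≤2 j z with z <? N
  ... | no _ = s≤s z≤n
  ... | yes _ with bit z j
  ...   | true  = z≤n
  ...   | false = ℕP.≤-refl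

  bumpSlack≤2 : ∀ s j z → bumpSlack s j z ≤ 2
  bumpSlack≤2 true  j z = ℕP.≤-trans (ℕP.m∸n≤m (bitCost j z) (bitCost j (suc z))) (bitCost≤2 j z)
  bumpSlack≤2 false j z = ℕP.≤-trans (ℕP.m∸n≤m (bitCost j (suc z)) (bitCost j z)) (bitCost≤2 j (suc z))

  bumpHeight≤ : ∀ s j z → j < r → bumpHeight s j z ≤ 2 * (r ∸ j)
  bumpHeight≤ s j z jr with z <? N
  ... | no _  = z≤n
  ... | yes _ = ℕP.≤-trans (ℕP.+-monoʳ-≤ (2 * (r ∸ suc j)) (bumpSlack≤2 s j z)) (ℕP.≤-reflexive 2m+2≡2[r∸j])
    where
    2m+2≡2[r∸j] : 2 * (r ∸ suc j) + 2 ≡ 2 * (r ∸ j)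
    2m+2≡2[r∸j] = trans (sym (ℕP.*-distribˡ-+ 2 (r ∸ suc j) 1))
                        (cong (2 *_) (trans (ℕP.+-comm (r ∸ suc j) 1) (sym (ℕP.+-∸-assoc 1 jr))))

  -- This is why riding below the target's level never pays off.
  bumpHeight-antitone : ∀ s j j′ z → j′ ≤ j → j < r → z < N → bumpHeight s j z ≤ bumpHeight s j′ z
  bumpHeight-antitone s j j′ z le jr zN with ℕP.m≤n⇒m<n∨m≡n le
  ... | inj₂ refl = ℕP.≤-refl
  ... | inj₁ j′<j rewrite bumpHeight-inside s j′ z zN =
    ℕP.≤-trans (bumpHeight≤ s j z jr) (ℕP.≤-trans (ℕP.*-monoʳ-≤ 2 (ℕP.∸-monoʳ-≤ r j′<j)) (ℕP.m≤m+n _ _))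

  crossCost-antitone : ∀ s j j′ z → j′ ≤ j → j < r → z < N → crossCost s j z ≤ crossCost s j′ z
  crossCost-antitone s j j′ z le jr zN = ℕP.+-monoʳ-≤ 3 (ℕP.*-monoʳ-≤ 2 (bumpHeight-antitone s j j′ z le jr zN))

  climbCost∸height : ∀ j j′ → climbCost j ∸ height (suc j′) 0 ≡ (j ∸ j′) * H
  climbCost∸height j j′ = trans (cong (climbCost j ∸_) (ℕP.+-identityʳ (suc j′ * H))) (sym (ℕP.*-distribʳ-∸ H (suc j) (suc j′)))

  height≤climbCost : ∀ j j′ → j′ ≤ j → height (suc j′) 0 ≤ climbCost j
  height≤climbCost j j′ le = ℕP.≤-trans (ℕP.≤-reflexive (ℕP.+-identityʳ (suc j′ * H))) (ℕP.*-monoˡ-≤ H (s≤s le))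

  height≰climbCost : ∀ j j′ → ¬ j′ ≤ j → ¬ height (suc j′) 0 ≤ climbCost j
  height≰climbCost j j′ j′≰j le =
    j′≰j (ℕP.≤-pred (ℕP.*-cancelʳ-≤ (suc j′) (suc j) H (ℕP.≤-trans (ℕP.≤-reflexive (sym (ℕP.+-identityʳ (suc j′ * H)))) le)))

  exit-column : ∀ z j → N ≤ z → z ∸ N ≡ suc j → z ≡ N + suc j
  exit-column z j p e = trans (sym (ℕP.m+[n∸m]≡n p)) (cong (N +_) e)

  column-junction-Φ : ∀ s j z j′ → z ≤ N + suc j′ → columnΦ s j z (suc j′) 0 ≡ junctionΦ s j z j′
  column-junction-Φ s j z j′ bd with ℕP.<-≤-connex z N | ℕP.≤-<-connex j′ j
  ... | inj₁ zN | inj₁ le = trans (column-inside s j z (suc j′) 0 zN (height≤climbCost j j′ le))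
                               (trans (cong (λ w → just (w + rideCost s j z)) (climbCost∸height j j′))
                                      (sym (junction-inside s j z j′ zN le)))
  ... | inj₁ zN | inj₂ j<j′ = trans (column-inside-above s j z (suc j′) 0 zN (height≰climbCost j j′ (ℕP.<⇒≱ j<j′)))
                                 (sym (junction-inside-above s j z j′ zN (ℕP.<⇒≱ j<j′)))
  ... | inj₂ zN | _ with z ∸ N ≟ suc j | j′ ≟ j
  ...   | yes e | yes refl = trans (column-exit s j z (suc j) 0 zN e (height≤climbCost j j ℕP.≤-refl))
                                   (sym (trans (junction-exit s j z zN bd) (cong just exit≡)))
    where
    exit≡ : 3 * (N + suc j ∸ z) + (climbCost j ∸ 1) ≡ height (suc j) 0 ∸ 1
    exit≡ = trans (cong (λ w → 3 * (N + suc j ∸ w) + (climbCost j ∸ 1)) (exit-column z j zN e))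
            (trans (cong (λ w → 3 * w + (climbCost j ∸ 1)) (ℕP.n∸n≡0 (N + suc j)))
                   (cong (_∸ 1) (sym (ℕP.+-identityʳ (climbCost j)))))
  ...   | yes e | no j′≢j = trans (column-exit-above s j z (suc j′) 0 zN e (height≰climbCost j j′ j′≰j))
                                  (sym (junction-beyond-other s j z j′ zN j′≢j))
    where
    j′≰j : ¬ j′ ≤ j
    j′≰j le = j′≢j (ℕP.≤-antisym le (ℕP.≤-pred (ℕP.+-cancelˡ-≤ N _ _ (subst (_≤ N + suc j′) (exit-column z j zN e) bd))))
  ...   | no e | yes refl = column-junction s j z zN e
  ...   | no e | no j′≢j = trans (column-beyond-other s j z (suc j′) zN e (λ q → j′≢j (ℕP.suc-injective q)))
                                 (sym (junction-beyond-other s j z j′ zN j′≢j))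

  climb-first : ∀ s j j′ z → j′ ≤ j → j < r → z < N →
                (j ∸ j′) * H + rideCost s j z ≤ crossCost s j′ z + ((j ∸ j′) * H + rideCost s j (suc z))
  climb-first s j j′ z le jr zN = begin
    (j ∸ j′) * H + rideCost s j z                            ≡⟨ cong ((j ∸ j′) * H +_) (rideCost-step s j z zN) ⟩
    (j ∸ j′) * H + (crossCost s j z + rideCost s j (suc z))  ≤⟨ ℕP.+-monoʳ-≤ ((j ∸ j′) * H)
                                                                 (ℕP.+-monoˡ-≤ _ (crossCost-antitone s j j′ z le jr zN)) ⟩
    (j ∸ j′) * H + (crossCost s j′ z + rideCost s j (suc z)) ≡⟨ x∙yz≈y∙xz ((j ∸ j′) * H) (crossCost s j′ z) (rideCost s j (suc z)) ⟩
    crossCost s j′ z + ((j ∸ j′) * H + rideCost s j (suc z)) ∎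
    where open ℕP.≤-Reasoning

  last-crossing : ∀ s j z → z < N → suc z ≡ N →
                  (j ∸ j) * H + rideCost s j z ≡ crossCost s j z + (3 * (N + suc j ∸ suc z) + (climbCost j ∸ 1))
  last-crossing s j z zN last = begin
    (j ∸ j) * H + rideCost s j z                            ≡⟨ cong (λ w → w * H + rideCost s j z) (ℕP.n∸n≡0 j) ⟩
    rideCost s j z                                          ≡⟨ rideCost-step s j z zN ⟩
    crossCost s j z + rideCost s j (suc z)                  ≡⟨ cong (λ w → crossCost s j z + rideCost s j w) last ⟩
    crossCost s j z + rideCost s j N                        ≡⟨ cong (crossCost s j z +_) (rideCost-N s j) ⟩
    crossCost s j z + exitCost j                            ≡⟨ cong (λ w → crossCost s j z + (3 * w + (climbCost j ∸ 1))) (sym (ℕP.m+n∸m≡n N (suc j))) ⟩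
    crossCost s j z + (3 * (N + suc j ∸ N) + (climbCost j ∸ 1)) ≡⟨ cong (λ w → crossCost s j z + (3 * (N + suc j ∸ w) + (climbCost j ∸ 1))) (sym last) ⟩
    crossCost s j z + (3 * (N + suc j ∸ suc z) + (climbCost j ∸ 1)) ∎
    where open ≡-Reasoning

  exit-crossing : ∀ s j z → N ≤ z → suc z ≤ N + suc j →
                  3 * (N + suc j ∸ z) + (climbCost j ∸ 1) ≡ crossCost s j z + (3 * (N + suc j ∸ suc z) + (climbCost j ∸ 1))
  exit-crossing s j z N≤z bd rewrite bumpHeight-beyond s j z N≤z | ℕP.+-∸-assoc 1 bd =
    trans (cong (_+ (climbCost j ∸ 1)) (ℕP.*-distribˡ-+ 3 1 (N + suc j ∸ suc z))) (ℕP.+-assoc 3 (3 * (N + suc j ∸ suc z)) (climbCost j ∸ 1))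

  junction-step : ∀ s j z j′ → j < r → ∀ β → junctionΦ s j (suc z) j′ ≡ just β →
                  ∃ λ α → junctionΦ s j z j′ ≡ just α × α ≤ crossCost s j′ z + β
  junction-step s j z j′ jr β eq with ℕP.≤-<-connex j′ j
  ... | inj₂ j<j′ = contradiction (trans (sym (junction-above s j (suc z) j′ (ℕP.<⇒≱ j<j′))) eq) nothing≢just
  ... | inj₁ j′≤j with ℕP.<-≤-connex z N
  ...   | inj₁ zN with ℕP.<-≤-connex (suc z) N
  ...     | inj₁ szN = _ , junction-inside s j z j′ zN j′≤j ,
                       subst (λ β → _ ≤ crossCost s j′ z + β) (just-injective (trans (sym (junction-inside s j (suc z) j′ szN j′≤j)) eq))
                             (climb-first s j j′ z j′≤j jr zN)
  ...     | inj₂ N≤sz with j′ ≟ j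
  ...       | no j′≢j = contradiction (trans (sym (junction-beyond-other s j (suc z) j′ N≤sz j′≢j)) eq) nothing≢just
  ...       | yes refl = _ , junction-inside s j z j zN j′≤j ,
                         ℕP.≤-reflexive (trans (last-crossing s j z zN last) (cong (crossCost s j z +_) (just-injective (trans (sym exit) eq))))
    where
    last : suc z ≡ N
    last = ℕP.≤-antisym zN N≤sz
    exit : junctionΦ s j (suc z) j ≡ just (3 * (N + suc j ∸ suc z) + (climbCost j ∸ 1))
    exit = junction-exit s j (suc z) N≤sz (subst (_≤ N + suc j) (sym last) (ℕP.m≤m+n N (suc j)))
  junction-step s j z j′ jr β eq | inj₁ j′≤j | inj₂ N≤z with j′ ≟ j | suc z ≤? N + suc j
  ... | no j′≢j | _ = contradiction (trans (sym (junction-beyond-other s j (suc z) j′ (ℕP.m≤n⇒m≤1+n N≤z) j′≢j)) eq) nothing≢just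
  ... | yes refl | no far = contradiction (trans (sym (junction-beyond-far s j (suc z) j (ℕP.m≤n⇒m≤1+n N≤z) far)) eq) nothing≢just
  ... | yes refl | yes bd = _ , junction-exit s j z N≤z (ℕP.≤-trans (ℕP.n≤1+n z) bd) ,
                            ℕP.≤-reflexive (trans (exit-crossing s j z N≤z bd) (cong (crossCost s j z +_) (just-injective (trans (sym exit) eq))))
    where exit = junction-exit s j (suc z) (ℕP.≤-trans N≤z (ℕP.n≤1+n z)) bd

  DropsAtMostOne : Maybe ℕ → Maybe ℕ → Set
  DropsAtMostOne φ φ′ = ∀ β → φ′ ≡ just β → ∃ λ α → φ ≡ just α × α ≤ suc β

  height<climbCost : ∀ {j b o} → b ≤ j → o < H → height b o < climbCost j
  height<climbCost {j} {b} {o} b≤j o<H =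
    ℕP.<-≤-trans (ℕP.+-monoʳ-< (b * H) o<H) (ℕP.≤-trans (ℕP.≤-reflexive (ℕP.+-comm (b * H) H)) (ℕP.*-monoˡ-≤ H (s≤s b≤j)))

  column-step : ∀ s j z {b o b′ o′} → z < N → height b′ o′ ≡ suc (height b o) →
                DropsAtMostOne (columnΦ s j z b o) (columnΦ s j z b′ o′)
  column-step s j z {b} {o} {b′} {o′} zN up β eq with ℕP.≤-<-connex (height b′ o′) (climbCost j)
  ... | inj₂ above = contradiction (trans (sym (column-inside-above s j z b′ o′ zN (ℕP.<⇒≱ above))) eq) nothing≢just
  ... | inj₁ le = suc β , trans (column-inside s j z b o zN le′) (cong just α≡) , ℕP.≤-refl
    where
    le′ : height b o ≤ climbCost j
    le′ = ℕP.≤-trans (ℕP.n≤1+n _) (subst (_≤ climbCost j) up le)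
    α≡ : climbCost j ∸ height b o + rideCost s j z ≡ suc β
    α≡ = trans (cong (_+ rideCost s j z) (ℕP.+-∸-assoc 1 (subst (_≤ climbCost j) up le)))
               (cong suc (trans (cong (λ h → climbCost j ∸ h + rideCost s j z) (sym up))
                                (just-injective (trans (sym (column-inside s j z b′ o′ zN le)) eq))))

  column-exit-inversion : ∀ s j z b o {β} → N ≤ z → columnΦ s j z b (suc o) ≡ just β →
                          z ∸ N ≡ suc j × β ≡ height b (suc o) ∸ 1
  column-exit-inversion s j z b o N≤z eq with z ∸ N ≟ suc j
  ... | no ne = contradiction (trans (sym (column-beyond-offset s j z b o N≤z ne)) eq) nothing≢just
  ... | yes e with height b (suc o) ≤? climbCost j
  ...   | no above = contradiction (trans (sym (column-exit-above s j z b (suc o) N≤z e above)) eq) nothing≢just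
  ...   | yes le = e , sym (just-injective (trans (sym (column-exit s j z b (suc o) N≤z e le)) eq))

  exit-descent : ∀ s j z {b o b′ o′} → N ≤ z → height b o ≡ suc (height b′ (suc o′)) →
                 (z ∸ N ≡ suc j → height b o ≤ climbCost j) → DropsAtMostOne (columnΦ s j z b o) (columnΦ s j z b′ (suc o′))
  exit-descent s j z {b} {o} {b′} {o′} N≤z down below β eq =
    let (e , β≡) = column-exit-inversion s j z b′ o′ N≤z eq
    in suc β , trans (column-exit s j z b o N≤z e (below e))
                     (cong just (trans (cong (_∸ 1) down) (trans (height-suc b′ o′) (cong suc (sym (trans β≡ (cong (_∸ 1) (height-suc b′ o′)))))))) ,
       ℕP.≤-refl

  descend-floor-bound : ∀ s j z b → N ≤ z → suc b < z ∸ N → DropsAtMostOne (columnΦ s j z (suc b) 1) (columnΦ s j z (suc b) 0)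
  descend-floor-bound s j z b N≤z b<z∸N β eq with z ∸ N ≟ suc j
  ... | yes e with height (suc b) 0 ≤? climbCost j
  ...   | no above = contradiction (trans (sym (column-exit-above s j z (suc b) 0 N≤z e above)) eq) nothing≢just
  ...   | yes le = _ , column-exit s j z (suc b) 1 N≤z e below , (begin
    height (suc b) 1 ∸ 1            ≡⟨ cong (_∸ 1) (height-suc (suc b) 0) ⟩
    height (suc b) 0                ≤⟨ ℕP.m≤n+m∸n (height (suc b) 0) 1 ⟩
    suc (height (suc b) 0 ∸ 1)      ≡⟨ cong suc (just-injective (trans (sym (column-exit s j z (suc b) 0 N≤z e le)) eq)) ⟩
    suc β                           ∎)
    where
    open ℕP.≤-Reasoning
    below : height (suc b) 1 ≤ climbCost j
    below = ℕP.<⇒≤ (height<climbCost (ℕP.≤-pred (subst (suc b <_) e b<z∸N)) (s≤s (s≤s z≤n)))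
  descend-floor-bound s j z b N≤z b<z∸N β eq | no ne with b ≟ j
  ... | yes refl =
    contradiction (trans (sym (junction-beyond-far s b z b N≤z far)) (trans (sym (column-junction s b z N≤z ne)) eq)) nothing≢just
    where
    far : ¬ z ≤ N + suc b
    far q = ℕP.<⇒≱ b<z∸N (ℕP.≤-trans (ℕP.∸-monoˡ-≤ N q) (ℕP.≤-reflexive (ℕP.m+n∸m≡n N (suc b))))
  ... | no b≢j = contradiction (trans (sym (column-beyond-other s j z (suc b) N≤z ne (λ q → b≢j (ℕP.suc-injective q)))) eq) nothing≢just

  bump-enter-bound : ∀ s j z j′ → j < r → DropsAtMostOne (columnΦ s j z (suc j′) 0) (bumpΦ s j z 1 j′ 0)
  bump-enter-bound s j z j′ jr β eq =
    let (bd , _ , β′ , Jeq , βe) = bump-inversion s j z 1 j′ 0 eq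
        (α , Ja , α≤) = junction-step s j z j′ jr β′ Jeq
    in α , trans (column-junction-Φ s j z j′ (ℕP.≤-trans bd (ℕP.+-monoʳ-≤ N (ℕP.n≤1+n j′)))) Ja ,
       subst (α ≤_) (cong suc βe) α≤

  bump-rise-bound : ∀ s j z j′ o → DropsAtMostOne (bumpΦ s j z 1 j′ o) (bumpΦ s j z 1 j′ (suc o))
  bump-rise-bound s j z j′ o β eq =
    let (bd , o<h , β′ , Jeq , βe) = bump-inversion s j z 1 j′ (suc o) eq
    in _ , trans (bump-within s j z 1 j′ o bd (ℕP.<⇒≤ o<h)) (cong (map _) Jeq) ,
       ℕP.≤-reflexive (trans (cong (_+ β′) (remaining (bumpHeight s j′ z) o<h)) (cong suc βe))
    where
    remaining : ∀ h {o} → o < h → (2 + 2 * h) ∸ o ≡ suc ((2 + 2 * h) ∸ suc o)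
    remaining h o<h = ℕP.+-∸-assoc 1 (ℕP.≤-trans o<h (ℕP.≤-trans (ℕP.m≤m+n h (h + 0)) (ℕP.m≤n+m (2 * h) 2)))

  bump-cross-bound : ∀ s j z j′ o → o ≡ bumpHeight s j′ z → DropsAtMostOne (bumpΦ s j z 1 j′ o) (bumpΦ s j z 2 j′ o)
  bump-cross-bound s j z j′ o refl β eq =
    let (bd , o≤h , β′ , Jeq , βe) = bump-inversion s j z 2 j′ o eq
    in _ , trans (bump-within s j z 1 j′ o bd o≤h) (cong (map _) Jeq) ,
       ℕP.≤-reflexive (trans (cong (_+ β′) (2+2h∸h o)) (cong suc βe))
    where
    2+2h∸h : ∀ h → (2 + 2 * h) ∸ h ≡ suc (suc h)
    2+2h∸h h = trans (cong (λ w → (2 + (h + w)) ∸ h) (ℕP.+-identityʳ h)) (ℕP.m+n∸n≡m (2 + h) h)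

  bump-fall-bound : ∀ s j z j′ o → suc o ≤ bumpHeight s j′ z → DropsAtMostOne (bumpΦ s j z 2 j′ (suc o)) (bumpΦ s j z 2 j′ o)
  bump-fall-bound s j z j′ o o<h β eq =
    let (bd , _ , β′ , Jeq , βe) = bump-inversion s j z 2 j′ o eq
    in _ , trans (bump-within s j z 2 j′ (suc o) bd o<h) (cong (map _) Jeq) , ℕP.≤-reflexive (cong suc βe)

  bump-leave-bound : ∀ s j z j′ → z ≤ N + j′ → DropsAtMostOne (bumpΦ s j z 2 j′ 0) (columnΦ s j (suc z) (suc j′) 0)
  bump-leave-bound s j z j′ bd β eq =
    _ , trans (bump-within s j z 2 j′ 0 bd z≤n) (cong (map _) (trans (sym (column-junction-Φ s j (suc z) j′ 1+z≤)) eq)) , ℕP.≤-refl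
    where
    1+z≤ : suc z ≤ N + suc j′
    1+z≤ = subst (suc z ≤_) (sym (ℕP.+-suc N j′)) (s≤s bd)

  Φ-elevated : ∀ s s′ j z a b o → 0 < height b o →
               Φ s j (cell s′ z a b o) ≡ (if does (s BoolP.≟ s′) then elevatedΦ s j z a b o else nothing)
  Φ-elevated s true  j z a zero    (suc o) _ = refl
  Φ-elevated s false j z a zero    (suc o) _ = refl
  Φ-elevated s true  j z a (suc b) o       _ = refl
  Φ-elevated s false j z a (suc b) o       _ = refl

  elevated-bound : ∀ s s′ j {z a b o z′ a′ b′ o′} → 0 < height b o → 0 < height b′ o′ →
                   (s ≡ s′ → DropsAtMostOne (elevatedΦ s j z a b o) (elevatedΦ s j z′ a′ b′ o′)) →
                   DropsAtMostOne (Φ s j (cell s′ z a b o)) (Φ s j (cell s′ z′ a′ b′ o′))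
  elevated-bound s s′ j {z} {a} {b} {o} {z′} {a′} {b′} {o′} h h′ bound
    rewrite Φ-elevated s s′ j z a b o h | Φ-elevated s s′ j z′ a′ b′ o′ h′ with s BoolP.≟ s′
  ... | yes s≡s′ = bound s≡s′
  ... | no  _    = λ β ()

  root-bound : ∀ s j z → z < N → DropsAtMostOne (rootΦ s j z 0) (columnΦ s j z 0 1)
  root-bound s j z zN β eq =
    _ , root-Φ s j z zN , ℕP.≤-reflexive (cong suc (just-injective (trans (sym (column-inside s j z 0 1 zN (s≤s z≤n))) eq)))

  Φ-step : ∀ s j → j < r → ∀ {c c′} → Step c c′ → InBounds c → DropsAtMostOne (Φ s j c) (Φ s j c′)
  Φ-step true  j jr (root-up {z} zN) _ = root-bound true j z zN
  Φ-step false j jr (root-up zN) _ β ()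
  Φ-step true  j jr (root-down zN) _ β ()
  Φ-step false j jr (root-down {z} zN) _ = root-bound false j z zN
  Φ-step s j jr (climb {s′} {z} {b} {o} zN _ tp _) _ =
    elevated-bound s s′ j tp (0<height-suc b o) (λ _ → column-step s j z zN (height-suc b o))
  Φ-step s j jr (climb-band {s′} {z} {b} {o} zN _ oH) _ =
    elevated-bound s s′ j (0<height-top b o oH) (0<height-level b 0) (λ _ → column-step s j z zN (height-carry b o oH))
  Φ-step s j jr (bump-enter {s′} {z} {j′} _) _ =
    elevated-bound s s′ j (0<height-level j′ 0) (0<height-level j′ 0) (λ _ → bump-enter-bound s j z j′ jr)
  Φ-step s j jr (bump-rise {s′} {z} {j′} {o} _) _ =
    elevated-bound s s′ j (0<height-level j′ o) (0<height-level j′ (suc o)) (λ _ → bump-rise-bound s j z j′ o)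
  Φ-step s j jr (bump-cross {s′} {z} {j′} {o} _ o≡h) _ =
    elevated-bound s s′ j (0<height-level j′ o) (0<height-level j′ o) (λ { refl → bump-cross-bound s j z j′ o o≡h })
  Φ-step s j jr (bump-fall {s′} {z} {j′} {o} o<h) _ =
    elevated-bound s s′ j (0<height-level j′ (suc o)) (0<height-level j′ o) (λ { refl → bump-fall-bound s j z j′ o o<h })
  Φ-step s j jr (bump-leave {s′} {z} {j′} bd) _ =
    elevated-bound s s′ j (0<height-level j′ 0) (0<height-level j′ 0) (λ _ → bump-leave-bound s j z j′ bd)
  Φ-step s j jr (descend-band {s′} {z} {b} N≤z b<z∸N) _ =
    elevated-bound s s′ j (0<height-level b 0) (0<height-top b (suc (2 * r)) refl)
      (λ _ → exit-descent s j z N≤z (height-carry b (suc (2 * r)) refl)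
                    (λ e → height≤climbCost j b (ℕP.≤-pred (subst (suc b ≤_) e b<z∸N))))
  Φ-step s j jr (descend {s′} {z} {b} {o} N≤z b<z∸N) (_ , _ , _ , o<H) =
    elevated-bound s s′ j (0<height-suc b (suc o)) (0<height-suc b o)
      (λ _ → exit-descent s j z N≤z (height-suc b (suc o))
                    (λ e → ℕP.<⇒≤ (height<climbCost (ℕP.≤-pred (subst (b <_) e b<z∸N)) o<H)))
  Φ-step s j jr (descend-floor {s′} {z} {b} N≤z b<z∸N) _ =
    elevated-bound s s′ j (0<height-level b 1) (0<height-level b 0) (λ _ → descend-floor-bound s j z b N≤z b<z∸N)
  Φ-step s j jr (arrive {z = z} N≤z _) _ β eq = contradiction (trans (sym (root-beyond s j z N≤z)) eq) nothing≢just

module Routes (r : ℕ) where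

  open Layout r
  open Potential r using (bumpHeight≤; bumpHeight-beyond)

  infixr 5 _∷_ _++_

  Move : Cell → Cell → Set
  Move c c′ = Step c c′ × InBounds c′

  data Route : Cell → Cell → ℕ → Set where
    []  : ∀ {c} → Route c c 0
    _∷_ : ∀ {c c′ c″ k} → Move c c′ → Route c′ c″ k → Route c c″ (suc k)

  _++_ : ∀ {c c′ c″ k k′} → Route c c′ k → Route c′ c″ k′ → Route c c″ (k + k′)
  []      ++ ρ′ = ρ′
  (σ ∷ ρ) ++ ρ′ = σ ∷ (ρ ++ ρ′)

  ascending : ∀ (f : ℕ → Cell) k → (∀ {i} → i < k → Move (f i) (f (suc i))) → Route (f 0) (f k) k
  ascending f zero    steps = []
  ascending f (suc k) steps = steps (s≤s z≤n) ∷ ascending (f ∘ suc) k (steps ∘ s≤s)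

  descending : ∀ (f : ℕ → Cell) k → (∀ {i} → i < k → Move (f (suc i)) (f i)) → Route (f k) (f 0) k
  descending f zero    steps = []
  descending f (suc k) steps = steps (ℕP.n<1+n k) ∷ descending f k (steps ∘ ℕP.m<n⇒m<1+n)

  root<Z : ∀ {z} → z < N → z < Z
  root<Z p = ℕP.≤-trans p (ℕP.≤-trans (ℕP.m≤m+n N r) (ℕP.n≤1+n _))

  crossing<Z : ∀ {z j} → z ≤ N + j → j < r → suc z < Z
  crossing<Z {z} {j} p jr = s≤s (ℕP.≤-trans (s≤s p) (ℕP.≤-trans (ℕP.≤-reflexive (sym (ℕP.+-suc N j))) (ℕP.+-monoʳ-≤ N jr)))

  exit<Z : ∀ {j} → j < r → N + suc j < Z
  exit<Z {j} jr = s≤s (ℕP.+-monoʳ-≤ N jr)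

  bumpHeight<H : ∀ s j z → j < r → bumpHeight s j z < H
  bumpHeight<H s j z jr = s≤s (ℕP.≤-trans (bumpHeight≤ s j z jr) (ℕP.≤-trans (ℕP.*-monoʳ-≤ 2 (ℕP.m∸n≤m r j)) (ℕP.n≤1+n _)))

  first-band : ∀ s z → z < N → 0 < r → Route (cell true z 0 0 0) (cell s z 0 1 0) H
  first-band s z zN 0<r = subst (Route (cell true z 0 0 0) (cell s z 0 1 0)) (cong suc (ℕP.+-comm (2 * r) 1))
    (leave-root s ∷ (ascending (λ i → cell s z 0 0 (suc i)) (2 * r) up ++ (climb-band zN 0<r refl , top) ∷ []))
    where
    leave-root : ∀ s → Move (cell true z 0 0 0) (cell s z 0 0 1)
    leave-root true  = root-up zN   , root<Z zN , s≤s z≤n , s≤s z≤n , s≤s (s≤s z≤n)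
    leave-root false = root-down zN , root<Z zN , s≤s z≤n , s≤s z≤n , s≤s (s≤s z≤n)
    up : ∀ {i} → i < 2 * r → Move (cell s z 0 0 (suc i)) (cell s z 0 0 (suc (suc i)))
    up {i} i<2r = climb zN 0<r (s≤s z≤n) (s≤s (s≤s i<2r)) , root<Z zN , s≤s z≤n , s≤s z≤n , s≤s (s≤s i<2r)
    top : InBounds (cell s z 0 1 0)
    top = root<Z zN , s≤s z≤n , s≤s 0<r , s≤s z≤n

  band : ∀ s z b → z < N → 0 < b → b < r → Route (cell s z 0 b 0) (cell s z 0 (suc b) 0) H
  band s z b zN 0<b br = subst (Route (cell s z 0 b 0) (cell s z 0 (suc b) 0)) (ℕP.+-comm (suc (2 * r)) 1)
    (ascending (cell s z 0 b) (suc (2 * r)) up ++ (climb-band zN br refl , top) ∷ [])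
    where
    up : ∀ {i} → i < suc (2 * r) → Move (cell s z 0 b i) (cell s z 0 b (suc i))
    up {i} i<H = climb zN br (ℕP.<-≤-trans 0<b (ℕP.≤-trans (ℕP.m≤m*n b H) (ℕP.m≤m+n (b * H) i))) (s≤s i<H) ,
                 root<Z zN , s≤s z≤n , ℕP.m<n⇒m<1+n br , s≤s i<H
    top : InBounds (cell s z 0 (suc b) 0)
    top = root<Z zN , s≤s z≤n , s≤s br , s≤s z≤n

  climb-route : ∀ s z j → z < N → j < r → Route (cell true z 0 0 0) (cell s z 0 (suc j) 0) (climbCost j)
  climb-route s z zero    zN jr = subst (Route (cell true z 0 0 0) (cell s z 0 1 0)) (sym (ℕP.+-identityʳ H)) (first-band s z zN jr)
  climb-route s z (suc j) zN jr = subst (Route (cell true z 0 0 0) (cell s z 0 (suc (suc j)) 0)) (ℕP.+-comm (climbCost j) H)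
    (climb-route s z j zN (ℕP.<-trans (ℕP.n<1+n j) jr) ++ band s z (suc j) zN (s≤s z≤n) jr)

  crossing : ∀ s z j → z ≤ N + j → j < r → Route (cell s z 0 (suc j) 0) (cell s (suc z) 0 (suc j) 0) (crossCost s j z)
  crossing s z j bd jr = subst (Route (cell s z 0 (suc j) 0) (cell s (suc z) 0 (suc j) 0)) (length h)
    ( (bump-enter bd , bounds 1<3 z≤n)
    ∷ ascending (cell s z 1 (suc j)) h (λ i<h → bump-rise i<h , bounds 1<3 i<h)
    ++ (bump-cross bd refl , bounds 2<3 ℕP.≤-refl)
    ∷ descending (cell s z 2 (suc j)) h (λ i<h → bump-fall i<h , bounds 2<3 (ℕP.<⇒≤ i<h))
    ++ (bump-leave bd , crossing<Z bd jr , s≤s z≤n , s≤s jr , s≤s z≤n)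
    ∷ [])
    where
    h : ℕ
    h = bumpHeight s j z
    1<3 : 1 < 3
    1<3 = s≤s (s≤s z≤n)
    2<3 : 2 < 3
    2<3 = s≤s (s≤s (s≤s z≤n))
    bounds : ∀ {a o} → a < 3 → o ≤ h → InBounds (cell s z a (suc j) o)
    bounds a<3 o≤h = ℕP.<-trans (ℕP.n<1+n z) (crossing<Z bd jr) , a<3 , s≤s jr , ℕP.≤-<-trans o≤h (bumpHeight<H s j z jr)
    length : ∀ h → 1 + (h + (1 + (h + 1))) ≡ 3 + 2 * h
    length h = cong suc (trans (ℕP.+-suc h (h + 1)) (cong suc (trans (ℕP.+-comm h (h + 1)) (trans (ℕP.+-assoc h 1 h)
               (trans (ℕP.+-comm h (1 + h)) (cong (λ w → suc (h + w)) (sym (ℕP.+-identityʳ h))))))))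

  ride : ∀ s j → j < r → ∀ k z → z + k ≡ N → Route (cell s z 0 (suc j) 0) (cell s N 0 (suc j) 0) (crossingsCost s j z k)
  ride s j jr zero    z e = subst (λ w → Route (cell s z 0 (suc j) 0) (cell s w 0 (suc j) 0) 0) (trans (sym (ℕP.+-identityʳ z)) e) []
  ride s j jr (suc k) z e = crossing s z j z≤N+j jr ++ ride s j jr k (suc z) (trans (sym (ℕP.+-suc z k)) e)
    where
    z≤N+j : z ≤ N + j
    z≤N+j = ℕP.≤-trans (ℕP.≤-trans (ℕP.m≤m+n z (suc k)) (ℕP.≤-reflexive e)) (ℕP.m≤m+n N j)

  exit-ride : ∀ s j → j < r → ∀ k z → N ≤ z → z + k ≡ N + suc j →
              Route (cell s z 0 (suc j) 0) (cell s (N + suc j) 0 (suc j) 0) (3 * k)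
  exit-ride s j jr zero z N≤z e = subst (λ w → Route (cell s z 0 (suc j) 0) (cell s w 0 (suc j) 0) 0) (trans (sym (ℕP.+-identityʳ z)) e) []
  exit-ride s j jr (suc k) z N≤z e = subst (Route (cell s z 0 (suc j) 0) (cell s (N + suc j) 0 (suc j) 0)) length
    (crossing s z j z≤N+j jr ++ exit-ride s j jr k (suc z) (ℕP.≤-trans N≤z (ℕP.n≤1+n z)) (trans (sym (ℕP.+-suc z k)) e))
    where
    z≤N+j : z ≤ N + j
    z≤N+j = ℕP.≤-pred (ℕP.≤-trans (ℕP.≤-trans (s≤s (ℕP.m≤m+n z k)) (ℕP.≤-reflexive (trans (sym (ℕP.+-suc z k)) e)))
                                  (ℕP.≤-reflexive (ℕP.+-suc N j)))
    length : crossCost s j z + 3 * k ≡ 3 * suc k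
    length = trans (cong (λ w → 3 + 2 * w + 3 * k) (bumpHeight-beyond s j z N≤z)) (sym (ℕP.*-suc 3 k))

  descend-level : ∀ s j → j < r → ∀ b → b ≤ j → Route (cell s (N + suc j) 0 (suc b) 0) (cell s (N + suc j) 0 b 1) (suc (2 * r))
  descend-level s j jr b b≤j =
    (descend-band N≤M (subst (suc b ≤_) (sym M∸N) (s≤s b≤j)) , exit<Z jr , s≤s z≤n , b<1+r , ℕP.≤-refl)
    ∷ descending (λ i → cell s (N + suc j) 0 b (suc i)) (2 * r)
                 (λ i<2r → descend N≤M (subst (b <_) (sym M∸N) (s≤s b≤j)) , exit<Z jr , s≤s z≤n , b<1+r , s≤s (ℕP.m<n⇒m<1+n i<2r))
    where
    N≤M : N ≤ N + suc j
    N≤M = ℕP.m≤m+n N (suc j)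
    M∸N : N + suc j ∸ N ≡ suc j
    M∸N = ℕP.m+n∸m≡n N (suc j)
    b<1+r : b < suc r
    b<1+r = ℕP.m<n⇒m<1+n (ℕP.≤-<-trans b≤j jr)

  descend-route : ∀ s j → j < r → ∀ b → b ≤ j → Route (cell s (N + suc j) 0 (suc b) 0) (cell s (N + suc j) 0 0 1) (climbCost b ∸ 1)
  descend-route s j jr zero b≤j =
    subst (Route (cell s (N + suc j) 0 1 0) (cell s (N + suc j) 0 0 1)) (cong suc (sym (ℕP.+-identityʳ (2 * r)))) (descend-level s j jr 0 b≤j)
  descend-route s j jr (suc b) b≤j =
    descend-level s j jr (suc b) b≤j
    ++ (descend-floor (ℕP.m≤m+n N (suc j)) (subst (suc b <_) (sym (ℕP.m+n∸m≡n N (suc j))) (s≤s b≤j)) ,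
        exit<Z jr , s≤s z≤n , s≤s (ℕP.≤-trans b≤j (ℕP.<⇒≤ jr)) , s≤s z≤n)
    ∷ descend-route s j jr b (ℕP.≤-trans (ℕP.n≤1+n b) b≤j)

  route : ∀ s j z → z < N → j < r → Route (cell true z 0 0 0) (cell s (N + suc j) 0 0 1) (climbCost j + rideCost s j z)
  route s j z zN jr =
    climb-route s z j zN jr
    ++ ride s j jr (N ∸ z) z (ℕP.m+[n∸m]≡n (ℕP.<⇒≤ zN))
    ++ exit-ride s j jr (suc j) N ℕP.≤-refl refl
    ++ descend-route s j jr j ℕP.≤-refl

module Telescoping (r : ℕ) where

  open Layout r
  open Potential r using (bumpHeight-inside; bumpHeight-beyond)

  bitCost-inside : ∀ j z → z < N → bitCost j z ≡ (if bit z j then 0 else 2)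
  bitCost-inside j z p rewrite <-yes p = refl

  bitCost-beyond : ∀ j z → N ℕ.≤ z → bitCost j z ≡ 1
  bitCost-beyond j z p rewrite dec-no (z <? N) (ℕP.≤⇒≯ p) = refl

  m∸n+n≡n∸m+m : ∀ m n → (m ∸ n) + n ≡ (n ∸ m) + m
  m∸n+n≡n∸m+m m n with ℕP.≤-total m n
  ... | inj₁ m≤n rewrite ℕP.m≤n⇒m∸n≡0 m≤n = sym (ℕP.m∸n+n≡m m≤n)
  ... | inj₂ n≤m rewrite ℕP.m≤n⇒m∸n≡0 n≤m = ℕP.m∸n+n≡m n≤m

  crossCost-telescope : ∀ j z → crossCost true j z + 2 * bitCost j (suc z) ≡ crossCost false j z + 2 * bitCost j z
  crossCost-telescope j z with ℕP.<-≤-connex z N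
  ... | inj₁ zN rewrite bumpHeight-inside true j z zN | bumpHeight-inside false j z zN =
    trans (regroup (2 * (r ∸ suc j)) (bitCost j z ∸ bitCost j (suc z)) (bitCost j (suc z)))
    (trans (cong (λ w → 3 + 2 * (2 * (r ∸ suc j)) + 2 * w) (m∸n+n≡n∸m+m (bitCost j z) (bitCost j (suc z))))
           (sym (regroup (2 * (r ∸ suc j)) (bitCost j (suc z) ∸ bitCost j z) (bitCost j z))))
    where
    regroup : ∀ B x t → 3 + 2 * (B + x) + 2 * t ≡ 3 + 2 * B + 2 * (x + t)
    regroup = solve 3 (λ B x t → con 3 :+ con 2 :* (B :+ x) :+ con 2 :* t := con 3 :+ con 2 :* B :+ con 2 :* (x :+ t)) refl
      where open +-*-Solver
  ... | inj₂ N≤z rewrite bumpHeight-beyond true j z N≤z | bumpHeight-beyond false j z N≤z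
                       | bitCost-beyond j z N≤z | bitCost-beyond j (suc z) (ℕP.≤-trans N≤z (ℕP.n≤1+n z)) = refl

  crossingsCost-telescope : ∀ j k z → crossingsCost true j z k + 2 * bitCost j (z + k) ≡ crossingsCost false j z k + 2 * bitCost j z
  crossingsCost-telescope j zero z rewrite ℕP.+-identityʳ z = refl
  crossingsCost-telescope j (suc k) z = begin
    crossCost true j z + crossingsCost true j (suc z) k + 2 * bitCost j (z + suc k)
      ≡⟨ ℕP.+-assoc (crossCost true j z) _ _ ⟩
    crossCost true j z + (crossingsCost true j (suc z) k + 2 * bitCost j (z + suc k))
      ≡⟨ cong (λ w → crossCost true j z + (crossingsCost true j (suc z) k + 2 * bitCost j w)) (ℕP.+-suc z k) ⟩
    crossCost true j z + (crossingsCost true j (suc z) k + 2 * bitCost j (suc z + k))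
      ≡⟨ cong (crossCost true j z +_) (crossingsCost-telescope j k (suc z)) ⟩
    crossCost true j z + (crossingsCost false j (suc z) k + 2 * bitCost j (suc z))
      ≡⟨ sym (ℕP.+-assoc (crossCost true j z) _ _) ⟩
    crossCost true j z + crossingsCost false j (suc z) k + 2 * bitCost j (suc z)
      ≡⟨ xy∙z≈xz∙y (crossCost true j z) _ _ ⟩
    crossCost true j z + 2 * bitCost j (suc z) + crossingsCost false j (suc z) k
      ≡⟨ cong (_+ crossingsCost false j (suc z) k) (crossCost-telescope j z) ⟩
    crossCost false j z + 2 * bitCost j z + crossingsCost false j (suc z) k
      ≡⟨ xy∙z≈xz∙y (crossCost false j z) _ _ ⟩
    crossCost false j z + crossingsCost false j (suc z) k + 2 * bitCost j z
      ∎
    where open ≡-Reasoning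

  rideCost-telescope : ∀ j z → z < N → rideCost true j z + 2 ≡ rideCost false j z + 2 * bitCost j z
  rideCost-telescope j z zN = begin
    crossingsCost true j z (N ∸ z) + exitCost j + 2                  ≡⟨ xy∙z≈xz∙y (crossingsCost true j z (N ∸ z)) _ _ ⟩
    crossingsCost true j z (N ∸ z) + 2 + exitCost j                  ≡⟨ cong (λ w → crossingsCost true j z (N ∸ z) + 2 * w + exitCost j)
                                                                            (sym (bitCost-beyond j N ℕP.≤-refl)) ⟩
    crossingsCost true j z (N ∸ z) + 2 * bitCost j N + exitCost j    ≡⟨ cong (λ w → crossingsCost true j z (N ∸ z) + 2 * bitCost j w + exitCost j)
                                                                            (sym (ℕP.m+[n∸m]≡n (ℕP.<⇒≤ zN))) ⟩
    crossingsCost true j z (N ∸ z) + 2 * bitCost j (z + (N ∸ z)) + exitCost j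
                                                                     ≡⟨ cong (_+ exitCost j) (crossingsCost-telescope j (N ∸ z) z) ⟩
    crossingsCost false j z (N ∸ z) + 2 * bitCost j z + exitCost j   ≡⟨ xy∙z≈xz∙y (crossingsCost false j z (N ∸ z)) _ _ ⟩
    crossingsCost false j z (N ∸ z) + exitCost j + 2 * bitCost j z   ∎
    where open ≡-Reasoning

  upper-shorter : ∀ j z → z < N → bit z j ≡ true → rideCost true j z + 2 ≡ rideCost false j z
  upper-shorter j z zN set = begin
    rideCost true j z + 2                 ≡⟨ rideCost-telescope j z zN ⟩
    rideCost false j z + 2 * bitCost j z  ≡⟨ cong (λ b → rideCost false j z + 2 * b) (trans (bitCost-inside j z zN) (cong (if_then 0 else 2) set)) ⟩
    rideCost false j z + 0                ≡⟨ ℕP.+-identityʳ _ ⟩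
    rideCost false j z                    ∎
    where open ≡-Reasoning

  lower-shorter : ∀ j z → z < N → bit z j ≡ false → rideCost true j z ≡ rideCost false j z + 2
  lower-shorter j z zN unset = ℕP.+-cancelʳ-≡ 2 _ _ (begin
    rideCost true j z + 2                 ≡⟨ rideCost-telescope j z zN ⟩
    rideCost false j z + 2 * bitCost j z  ≡⟨ cong (λ b → rideCost false j z + 2 * b) (trans (bitCost-inside j z zN) (cong (if_then 0 else 2) unset)) ⟩
    rideCost false j z + 4                ≡⟨ sym (ℕP.+-assoc (rideCost false j z) 2 2) ⟩
    rideCost false j z + 2 + 2            ∎)
    where open ≡-Reasoning

module CellGraph (r : ℕ) where

  open Layout r
  open Potential r using (Φ; DropsAtMostOne; Φ-step)
  open Routes r using (Route; []; _∷_)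

  #cells : ℕ
  #cells = 2 * (Z * (3 * (suc r * H)))

  sideIndex : Bool → Fin 2
  sideIndex true  = Fin.zero
  sideIndex false = Fin.suc Fin.zero

  indexSide : Fin 2 → Bool
  indexSide Fin.zero    = true
  indexSide (Fin.suc _) = false

  indexSide-sideIndex : ∀ s → indexSide (sideIndex s) ≡ s
  indexSide-sideIndex true  = refl
  indexSide-sideIndex false = refl

  sideIndex-indexSide : ∀ i → sideIndex (indexSide i) ≡ i
  sideIndex-indexSide Fin.zero             = refl
  sideIndex-indexSide (Fin.suc Fin.zero)   = refl

  vertex : (c : Cell) → InBounds c → Fin #cells
  vertex (cell s z a b o) (z<Z , a<3 , b<r , o<H) =
    combine (sideIndex s) (combine (fromℕ< z<Z) (combine (fromℕ< a<3) (combine (fromℕ< b<r) (fromℕ< o<H))))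

  decode-offset : Bool → ℕ → ℕ → Fin (suc r) × Fin H → Cell
  decode-offset s z a (b , o) = cell s z a (toℕ b) (toℕ o)

  decode-lane : Bool → ℕ → Fin 3 × Fin (suc r * H) → Cell
  decode-lane s z (a , w) = decode-offset s z (toℕ a) (remQuot H w)

  decode-column : Bool → Fin Z × Fin (3 * (suc r * H)) → Cell
  decode-column s (z , w) = decode-lane s (toℕ z) (remQuot (suc r * H) w)

  decode-side : Fin 2 × Fin (Z * (3 * (suc r * H))) → Cell
  decode-side (i , w) = decode-column (indexSide i) (remQuot (3 * (suc r * H)) w)

  decode : Fin #cells → Cell
  decode v = decode-side (remQuot (Z * (3 * (suc r * H))) v)

  decode-vertex : ∀ c (p : InBounds c) → decode (vertex c p) ≡ c
  decode-vertex (cell s z a b o) (z<Z , a<3 , b<r , o<H) = begin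
    decode-side (remQuot _ (combine (sideIndex s) w₁))          ≡⟨ cong decode-side (FinP.remQuot-combine (sideIndex s) w₁) ⟩
    decode-column (indexSide (sideIndex s)) (remQuot _ w₁)      ≡⟨ cong (λ s′ → decode-column s′ (remQuot _ w₁)) (indexSide-sideIndex s) ⟩
    decode-column s (remQuot _ (combine (fromℕ< z<Z) w₂))       ≡⟨ cong (decode-column s) (FinP.remQuot-combine (fromℕ< z<Z) w₂) ⟩
    decode-lane s (toℕ (fromℕ< z<Z)) (remQuot _ w₂)             ≡⟨ cong (λ z′ → decode-lane s z′ (remQuot _ w₂)) (FinP.toℕ-fromℕ< z<Z) ⟩
    decode-lane s z (remQuot _ (combine (fromℕ< a<3) w₃))       ≡⟨ cong (decode-lane s z) (FinP.remQuot-combine (fromℕ< a<3) w₃) ⟩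
    decode-offset s z (toℕ (fromℕ< a<3)) (remQuot _ w₃)         ≡⟨ cong (λ a′ → decode-offset s z a′ (remQuot _ w₃)) (FinP.toℕ-fromℕ< a<3) ⟩
    decode-offset s z a (remQuot H (combine (fromℕ< b<r) (fromℕ< o<H))) ≡⟨ cong (decode-offset s z a) (FinP.remQuot-combine (fromℕ< b<r) (fromℕ< o<H)) ⟩
    cell s z a (toℕ (fromℕ< b<r)) (toℕ (fromℕ< o<H))            ≡⟨ cong₂ (cell s z a) (FinP.toℕ-fromℕ< b<r) (FinP.toℕ-fromℕ< o<H) ⟩
    cell s z a b o                                              ∎
    where
    open ≡-Reasoning
    w₃ : Fin (suc r * H)
    w₃ = combine (fromℕ< b<r) (fromℕ< o<H)
    w₂ : Fin (3 * (suc r * H))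
    w₂ = combine (fromℕ< a<3) w₃
    w₁ : Fin (Z * (3 * (suc r * H)))
    w₁ = combine (fromℕ< z<Z) w₂

  decode-inBounds : ∀ v → InBounds (decode v)
  decode-inBounds v = FinP.toℕ<n _ , FinP.toℕ<n _ , FinP.toℕ<n _ , FinP.toℕ<n _

  remQuot-injective : ∀ {m} k {x y : Fin (m * k)} → remQuot {m} k x ≡ remQuot k y → x ≡ y
  remQuot-injective {m} k {x} {y} eq =
    trans (sym (FinP.combine-remQuot {m} k x)) (trans (cong (uncurry combine) eq) (FinP.combine-remQuot {m} k y))

  indexSide-injective : ∀ {i j} → indexSide i ≡ indexSide j → i ≡ j
  indexSide-injective {i} {j} e = trans (sym (sideIndex-indexSide i)) (trans (cong sideIndex e) (sideIndex-indexSide j))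

  decode-injective : ∀ {u v} → decode u ≡ decode v → u ≡ v
  decode-injective eq =
    remQuot-injective _ (×-≡,≡→≡ (indexSide-injective (cong Cell.side eq) ,
    remQuot-injective _ (×-≡,≡→≡ (FinP.toℕ-injective (cong Cell.column eq) ,
    remQuot-injective _ (×-≡,≡→≡ (FinP.toℕ-injective (cong Cell.lane eq) ,
    remQuot-injective _ (×-≡,≡→≡ (FinP.toℕ-injective (cong Cell.level eq) , FinP.toℕ-injective (cong Cell.offset eq)))))))))

  inBounds? : ∀ c → Dec (InBounds c)
  inBounds? (cell s z a b o) = z <? Z ×-dec a <? 3 ×-dec b <? suc r ×-dec o <? H

  -- Each cell has two out-edges, one per slot; an empty slot, or a step leaving the
  -- drawn cells, gives a loop.
  slot : Fin 2 → (c : Cell) → Slot c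
  slot Fin.zero    = primary
  slot (Fin.suc _) = secondary

  target : Fin #cells → Maybe Cell → Fin #cells
  target v nothing = v
  target v (just c) with inBounds? c
  ... | yes p = vertex c p
  ... | no _  = v

  G : Digraph
  G = record
    { n   = #cells
    ; m   = #cells * 2
    ; src = λ e → proj₁ (remQuot {#cells} 2 e)
    ; tgt = λ e → let (v , k) = remQuot {#cells} 2 e in target v (map proj₁ (slot k (decode v)))
    }

  target-in : ∀ v c (p : InBounds c) → target v (just c) ≡ vertex c p
  target-in v c p with inBounds? c
  ... | yes _ = refl
  ... | no  q = contradiction p q

  EdgeStep : Edge G → Set
  EdgeStep e = tgt G e ≡ src G e ⊎ Σ Cell λ c′ → Step (decode (src G e)) c′ × decode (tgt G e) ≡ c′

  edge-step : ∀ e → EdgeStep e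
  edge-step e = slot-target (proj₁ (remQuot {#cells} 2 e)) (slot (proj₂ (remQuot {#cells} 2 e)) (decode (proj₁ (remQuot {#cells} 2 e))))
    where
    slot-target : ∀ v (σ : Slot (decode v)) →
                  target v (map proj₁ σ) ≡ v ⊎ Σ Cell λ c′ → Step (decode v) c′ × decode (target v (map proj₁ σ)) ≡ c′
    slot-target v nothing = inj₁ refl
    slot-target v (just (c′ , st)) with inBounds? c′
    ... | yes p = inj₂ (c′ , st , decode-vertex c′ p)
    ... | no  _ = inj₁ refl

  vertexX vertexY : Vtx G → ℕ
  vertexX v = cellX (decode v)
  vertexY v = cellY (decode v)

  UnitEdgeᵛ : Vtx G → Vtx G → Set
  UnitEdgeᵛ u w = u ≡ w ⊎ UnitStep vertexX vertexY u w ⊎ UnitStep vertexX vertexY w u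

  unit-edge : ∀ e → UnitEdgeᵛ (src G e) (tgt G e)
  unit-edge e = slot-unit (proj₁ (remQuot {#cells} 2 e)) (slot (proj₂ (remQuot {#cells} 2 e)) (decode (proj₁ (remQuot {#cells} 2 e))))
    where
    slot-unit : ∀ v (σ : Slot (decode v)) → UnitEdgeᵛ v (target v (map proj₁ σ))
    slot-unit v nothing = inj₁ refl
    slot-unit v (just (c′ , st)) with inBounds? c′
    ... | yes p = inj₂ (subst (UnitEdge (decode v)) (sym (decode-vertex c′ p)) (step-unit st (decode-inBounds v) p))
    ... | no  _ = inj₁ refl

  lattice-injective : ∀ {u v} → vertexX u ≡ vertexX v → vertexY u ≡ vertexY v → u ≡ v
  lattice-injective {u} {v} ex ey = decode-injective (cell-lattice-injective (decode-inBounds u) (decode-inBounds v) ex ey)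

  planar : Planar G
  planar = UnitGrid.drawing G vertexX vertexY lattice-injective unit-edge

  slot-edge : ∀ v k → src G (combine v k) ≡ v × tgt G (combine v k) ≡ target v (map proj₁ (slot k (decode v)))
  slot-edge v k = cong proj₁ (FinP.remQuot-combine {#cells} {2} v k) ,
                  cong (λ (x : Fin #cells × Fin 2) → target (proj₁ x) (map proj₁ (slot (proj₂ x) (decode (proj₁ x)))))
                       (FinP.remQuot-combine {#cells} {2} v k)

  slot-move : ∀ {c c′} k (p : InBounds c) (p′ : InBounds c′) → map proj₁ (slot k c) ≡ just c′ →
              Σ (Edge G) λ e → src G e ≡ vertex c p × tgt G e ≡ vertex c′ p′
  slot-move {c} {c′} k p p′ chosen =
    combine (vertex c p) k , proj₁ (slot-edge (vertex c p) k) ,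
    trans (proj₂ (slot-edge (vertex c p) k))
          (trans (cong (λ d → target (vertex c p) (map proj₁ (slot k d))) (decode-vertex c p))
                 (trans (cong (target (vertex c p)) chosen) (target-in (vertex c p) c′ p′)))

  step-edge : ∀ {c c′} → Step c c′ → (p : InBounds c) (p′ : InBounds c′) →
              Σ (Edge G) λ e → src G e ≡ vertex c p × tgt G e ≡ vertex c′ p′
  step-edge {c} {c′} st p p′ with slot-of-step st
  ... | inj₁ chosen = slot-move {c} {c′} Fin.zero p p′ chosen
  ... | inj₂ chosen = slot-move {c} {c′} (Fin.suc Fin.zero) p p′ chosen

  route-walk : ∀ {c c′ k} → Route c c′ k → (p : InBounds c) (p′ : InBounds c′) → Walk G (vertex c p) (vertex c′ p′) k
  route-walk [] p p′ = nil
  route-walk {c′ = c″} {suc k} ((st , q) ∷ ρ) p p″ =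
    let (e , src≡ , tgt≡) = step-edge st p q
    in subst (λ x → Walk G x (vertex c″ p″) (suc k)) src≡
             (cons e (subst (λ x → Walk G x (vertex c″ p″) k) (sym tgt≡) (route-walk ρ q p″)))

  edge-bound : ∀ s j → j < r → ∀ e → DropsAtMostOne (Φ s j (decode (src G e))) (Φ s j (decode (tgt G e)))
  edge-bound s j jr e = from-step (edge-step e)
    where
    from-step : EdgeStep e → DropsAtMostOne (Φ s j (decode (src G e))) (Φ s j (decode (tgt G e)))
    from-step (inj₁ loop) β eq = β , subst (λ x → Φ s j (decode x) ≡ just β) loop eq , ℕP.n≤1+n β
    from-step (inj₂ (c′ , st , c′≡)) β eq = Φ-step s j jr st (decode-inBounds (src G e)) β (trans (cong (Φ s j) (sym c′≡)) eq)

  walk-bound : ∀ s j → j < r → ∀ {u w k} → Walk G u w k → Φ s j (decode w) ≡ just 0 →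
               ∃ λ α → Φ s j (decode u) ≡ just α × α ≤ k
  walk-bound s j jr nil      Φw≡0 = 0 , Φw≡0 , z≤n
  walk-bound s j jr (cons e ω) Φw≡0 =
    let (β , Φβ , β≤k) = walk-bound s j jr ω Φw≡0
        (α , Φα , α≤1+β) = edge-bound s j jr e β Φβ
    in α , Φα , ℕP.≤-trans α≤1+β (s≤s β≤k)

module Shattering (r : ℕ) where

  open Layout r
  open Potential r using (Φ; root-Φ; column-exit)
  open Routes r using (route; root<Z; exit<Z)
  open Telescoping r using (upper-shorter; lower-shorter)
  open CellGraph r

  rootCell : ℕ → Cell
  rootCell z = cell true z 0 0 0

  exitCell : Bool → ℕ → Cell
  exitCell s j = cell s (N + suc j) 0 0 1

  terminalCell : ℕ → Cell
  terminalCell j = cell true (N + suc j) 0 0 0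

  module _ {j : ℕ} (jr : j < r) where

    exit-bounds : ∀ s → InBounds (exitCell s j)
    exit-bounds s = exit<Z jr , s≤s z≤n , s≤s z≤n , s≤s (s≤s z≤n)

    terminal-bounds : InBounds (terminalCell j)
    terminal-bounds = exit<Z jr , s≤s z≤n , s≤s z≤n , s≤s z≤n

    exit : Bool → Vtx G
    exit s = vertex (exitCell s j) (exit-bounds s)

    terminal : Vtx G
    terminal = vertex (terminalCell j) terminal-bounds

    exit-move : ∀ s → Σ (Edge G) λ e → src G e ≡ exit s × tgt G e ≡ terminal
    exit-move s = slot-move {exitCell s j} {terminalCell j} Fin.zero (exit-bounds s) terminal-bounds
                    (primary-arrive {s} (ℕP.m≤m+n N (suc j)) (subst (0 <_) (sym (ℕP.m+n∸m≡n N (suc j))) (s≤s z≤n)))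

    exitEdge : Bool → Edge G
    exitEdge s = proj₁ (exit-move s)

    exitEdge-src : ∀ s → src G (exitEdge s) ≡ exit s
    exitEdge-src s = proj₁ (proj₂ (exit-move s))

    exitEdge-tgt : ∀ s → tgt G (exitEdge s) ≡ terminal
    exitEdge-tgt s = proj₂ (proj₂ (exit-move s))

    Φ-exit : ∀ s → Φ s j (decode (exit s)) ≡ just 0
    Φ-exit s = trans (cong (Φ s j) (decode-vertex (exitCell s j) (exit-bounds s))) (Φ-at-exit s)
      where
      Φ-at-exit : ∀ s → Φ s j (exitCell s j) ≡ just 0
      Φ-at-exit true  = column-exit true  j (N + suc j) 0 1 (ℕP.m≤m+n N (suc j)) (ℕP.m+n∸m≡n N (suc j)) (s≤s z≤n)
      Φ-at-exit false = column-exit false j (N + suc j) 0 1 (ℕP.m≤m+n N (suc j)) (ℕP.m+n∸m≡n N (suc j)) (s≤s z≤n)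

    secondary-exit : ∀ s → map proj₁ (secondary (exitCell s j)) ≡ nothing
    secondary-exit true  = refl
    secondary-exit false = refl

    arrive-only : ∀ {c} → Step c (terminalCell j) → ∃ λ s → c ≡ exitCell s j
    arrive-only (arrive _ _) = _ , refl

    terminal-in-edge : ∀ e → tgt G e ≡ terminal → src G e ≡ terminal ⊎ ∃ λ s → e ≡ exitEdge s
    terminal-in-edge e into = from-step (edge-step e)
      where
      from-step : EdgeStep e → src G e ≡ terminal ⊎ ∃ λ s → e ≡ exitEdge s
      from-step (inj₁ loop) = inj₁ (trans (sym loop) into)
      from-step (inj₂ (c′ , st , c′≡)) = by-slot (proj₂ (remQuot {#cells} 2 e)) refl
        where
        from-exit : ∃ λ s → decode (src G e) ≡ exitCell s j
        from-exit = arrive-only (subst (Step (decode (src G e)))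
                                       (trans (sym c′≡) (trans (cong decode into) (decode-vertex (terminalCell j) terminal-bounds))) st)
        by-slot : ∀ k → proj₂ (remQuot {#cells} 2 e) ≡ k → src G e ≡ terminal ⊎ ∃ λ s → e ≡ exitEdge s
        by-slot Fin.zero k≡ = let (s , from) = from-exit in
          inj₂ (s , trans (sym (FinP.combine-remQuot {#cells} 2 e))
                          (cong₂ (combine {#cells} {2}) (decode-injective {src G e} {exit s} (trans from (sym (decode-vertex (exitCell s j) (exit-bounds s))))) k≡))
        by-slot (Fin.suc Fin.zero) k≡ = let (s , from) = from-exit in
          inj₁ (trans (sym (trans (cong (λ k → target (src G e) (map proj₁ (slot k (decode (src G e))))) k≡)
                                  (cong (target (src G e)) (trans (cong (λ c → map proj₁ (secondary c)) from) (secondary-exit s)))))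
                      into)

  module _ {z : ℕ} (zN : z < N) where

    root-bounds : InBounds (rootCell z)
    root-bounds = root<Z zN , s≤s z≤n , s≤s z≤n , s≤s z≤n

    root : Vtx G
    root = vertex (rootCell z) root-bounds

    module _ {j : ℕ} (jr : j < r) where

      routeLength : Bool → ℕ
      routeLength s = climbCost j + rideCost s j z

      exit-lower-bound : ∀ s {k} → Walk G root (exit jr s) k → routeLength s ≤ k
      exit-lower-bound s {k} ω =
        let (α , Φα , α≤k) = walk-bound s j jr ω (Φ-exit jr s)
        in subst (_≤ k) (just-injective (trans (sym Φα) Φ-root)) α≤k
        where
        Φ-root : Φ s j (decode root) ≡ just (routeLength s)
        Φ-root = trans (cong (Φ s j) (decode-vertex (rootCell z) root-bounds)) (root-Φ s j z zN)

      terminal-walk : ∀ s → Walk G root (terminal jr) (routeLength s + 1)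
      terminal-walk s = route-walk (route s j z zN jr) root-bounds (exit-bounds jr s) ++ʷ exit-walk
        where
        exit-walk : Walk G (exit jr s) (terminal jr) 1
        exit-walk = subst₂ (λ u w → Walk G u w 1) (exitEdge-src jr s) (exitEdge-tgt jr s) (cons (exitEdge jr s) nil)

      root≢terminal : root ≢ terminal jr
      root≢terminal eq = ℕP.<⇒≢ (ℕP.<-≤-trans zN (ℕP.m≤m+n N (suc j))) (cong Cell.column cells≡)
        where
        cells≡ : rootCell z ≡ terminalCell j
        cells≡ = trans (sym (decode-vertex (rootCell z) root-bounds)) (trans (cong decode eq) (decode-vertex (terminalCell j) (terminal-bounds jr)))

  module ParentEdges (T : SPTSystem G) where
    open SPTSystem T using (par; par-reach; par-edge; τ)

    module _ {z j : ℕ} (zN : z < N) (jr : j < r) where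

      -- A parent edge into the terminal lies on a shortest path, so its side's route is shortest.
      longer-exit-unused : ∀ s → rideCost (not s) j z < rideCost s j z → ¬ τ (root zN) (exitEdge jr s)
      longer-exit-unused s longer (w , par≡) with par-edge (root zN) w (exitEdge jr s) par≡
      ... | into , k , dist-exit , dist-w =
        ℕP.<-irrefl refl (ℕP.≤-<-trans k≤other (ℕP.<-≤-trans (ℕP.+-monoʳ-< (climbCost j) longer) own≤k))
        where
        own≤k : routeLength zN jr s ≤ k
        own≤k = exit-lower-bound zN jr s (subst (λ x → Walk G (root zN) x k) (exitEdge-src jr s) (proj₁ dist-exit))
        other : Walk G (root zN) w (routeLength zN jr (not s) + 1)
        other = subst (λ x → Walk G (root zN) x _) (trans (sym (exitEdge-tgt jr s)) into) (terminal-walk zN jr (not s))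
        k≤other : k ≤ routeLength zN jr (not s)
        k≤other = ℕP.≤-pred (subst (suc k ≤_) (ℕP.+-comm (routeLength zN jr (not s)) 1) (proj₂ dist-w _ other))

      shorter-exit-used : ∀ s → rideCost s j z < rideCost (not s) j z → τ (root zN) (exitEdge jr s)
      shorter-exit-used s shorter = from-parent (par-reach (root zN) (terminal jr) (root≢terminal zN jr) (_ , terminal-walk zN jr s))
        where
        side-cases : ∀ s′ → s′ ≡ s ⊎ s′ ≡ not s
        side-cases s′ with s′ BoolP.≟ s
        ... | yes s′≡s = inj₁ s′≡s
        ... | no  s′≢s = inj₂ (BoolP.¬-not s′≢s)
        from-in-edge : ∀ {e} → par (root zN) (terminal jr) ≡ just e → src G e ≡ terminal jr ⊎ ∃ (λ s′ → e ≡ exitEdge jr s′) →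
                       ∀ {k} → Dist G (root zN) (src G e) k → Dist G (root zN) (terminal jr) (suc k) → τ (root zN) (exitEdge jr s)
        from-in-edge par≡ (inj₁ src≡t) {k} dist-src dist-t =
          contradiction (proj₂ dist-t k (subst (λ x → Walk G (root zN) x k) src≡t (proj₁ dist-src))) ℕP.1+n≰n
        from-in-edge par≡ (inj₂ (s′ , refl)) _ _ with side-cases s′
        ... | inj₁ refl = terminal jr , par≡
        ... | inj₂ refl = contradiction (terminal jr , par≡)
                            (longer-exit-unused (not s)
                               (subst (λ b → rideCost b j z < rideCost (not s) j z) (sym (BoolP.not-involutive s)) shorter))
        from-parent : ∃ (λ e → par (root zN) (terminal jr) ≡ just e) → τ (root zN) (exitEdge jr s)
        from-parent (e , par≡) =
          let (into , k , dist-src , dist-t) = par-edge (root zN) (terminal jr) e par≡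
          in from-in-edge par≡ (terminal-in-edge jr e into) dist-src dist-t

  exitEdges : Fin r → Edge G
  exitEdges i = exitEdge (FinP.toℕ<n i) true

  exitEdges-injective : Injective _≡_ _≡_ exitEdges
  exitEdges-injective {i} {i′} eq = FinP.toℕ-injective (ℕP.suc-injective (ℕP.+-cancelˡ-≡ N _ _ (cong Cell.column cells≡)))
    where
    exit≡ : exit (FinP.toℕ<n i) true ≡ exit (FinP.toℕ<n i′) true
    exit≡ = trans (sym (exitEdge-src (FinP.toℕ<n i) true)) (trans (cong (src G) eq) (exitEdge-src (FinP.toℕ<n i′) true))
    cells≡ : exitCell true (toℕ i) ≡ exitCell true (toℕ i′)
    cells≡ = trans (sym (decode-vertex _ (exit-bounds (FinP.toℕ<n i) true)))
                   (trans (cong decode exit≡) (decode-vertex _ (exit-bounds (FinP.toℕ<n i′) true)))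

  module _ (T : SPTSystem G) where
    open ParentEdges T
    open SPTSystem T using (τ)

    shattered : Shattered G T exitEdges
    shattered S = root z<N , λ i → mk⇔ (selected i) (selected⁻¹ i)
      where
      z<N : fromBits S < N
      z<N = fromBits< S
      selected : ∀ i → S i ≡ true → τ (root z<N) (exitEdges i)
      selected i Si = shorter-exit-used z<N (FinP.toℕ<n i) true
        (subst (rideCost true (toℕ i) (fromBits S) <_) (upper-shorter (toℕ i) (fromBits S) z<N (trans (bit-fromBits S i) Si))
               (ℕP.m<m+n _ (s≤s z≤n)))
      selected⁻¹ : ∀ i → τ (root z<N) (exitEdges i) → S i ≡ true
      selected⁻¹ i τi with S i in Si
      ... | true  = refl
      ... | false = contradiction τi (longer-exit-unused z<N (FinP.toℕ<n i) true
        (subst (rideCost false (toℕ i) (fromBits S) <_) (sym (lower-shorter (toℕ i) (fromBits S) z<N (trans (bit-fromBits S i) Si)))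
               (ℕP.m<m+n _ (s≤s z≤n))))

theorem1p6 : (r : ℕ) → r ≥ 1 →
    Σ Digraph λ G → Planar G × Σ (Fin r → Edge G) λ X →
      Injective _≡_ _≡_ X × ((T : SPTSystem G) → Shattered G T X)
-- The construction needs no lower bound on r.
theorem1p6 r _ = G , planar , exitEdges , exitEdges-injective , shattered
  where
  open CellGraph r using (G; planar)
  open Shattering r using (exitEdges; exitEdges-injective; shattered)
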